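{- Let $\mu=(\mu_1,\mu_2,\dots)$ be a composition of $n$ and let $T$ be a standard Young tableau of shape $\lambda\vdash n$. Then the probability that a $\mu$ shuffle produces a permutation with RSK recording tableau $T$ equals $K_{\lambda\mu}\big/\binom{n}{\mu_1,\mu_2,\dots}$.
   Context: A $\mu$ shuffle of an $n$-card deck: cut the deck into consecutive piles of sizes $\mu_1,\mu_2,\dots$ and then choose uniformly at random one of the $\binom{n}{\mu_1,\mu_2,\dots}$ possible interleavings of the piles (preserving the order within each pile). $K_{\lambda\mu}$ is the Kostka number: the number of semistandard Young tableaux of shape $\lambda$ in which $i$ appears $\mu_i$ times. -}

module Defs where

open import Data.Nat using (ℕ; zero; suc; _+_; _*_; _∸_; _<_; _≤_; _<ᵇ_; _≟_; _<?_; _≤?_; NonZero)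
open import Data.Nat.Combinatorics using (_C_)
open import Data.Bool using (Bool; true; false; if_then_else_)
open import Data.List using (List; []; _∷_; _++_; [_]; length; map; concat; concatMap; filter; upTo)
open import Data.Nat.ListAction using (sum)
open import Data.List.Properties using (≡-dec)
open import Data.List.Relation.Unary.All using (All)
open import Data.List.Relation.Unary.Linked using (Linked; linked?)
open import Data.List.Relation.Binary.Permutation.Propositional using (_↭_)
open import Data.Maybe using (Maybe; just; nothing)
open import Data.Product using (_×_; _,_; proj₁; proj₂)
open import Data.Product.Properties using () renaming (≡-dec to ×-≡-dec)
open import Data.Unit using (⊤; tt)
open import Data.Empty using (⊥)
open import Relation.Nullary using (Dec; yes; no; does; _×-dec_)
open import Relation.Unary using (Decidable)
open import Relation.Binary.PropositionalEquality using (_≡_)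
open import Data.Integer using (+_)
open import Data.Rational using (ℚ; _/_; 0ℚ)

IsComposition : ℕ → List ℕ → Set
IsComposition n μ = All (λ m → 0 < m) μ × sum μ ≡ n

IsPartition : ℕ → List ℕ → Set
IsPartition n λ' = Linked (λ a b → b ≤ a) λ' × All (λ m → 0 < m) λ' × sum λ' ≡ n

-- tableaux are lists of rows (English notation, top row first)
Tableau : Set
Tableau = List (List ℕ)

shape : Tableau → List ℕ
shape = map length

-- ColRel R r r' : the row r' lies below the row r, i.e. is not longer,
-- and each entry of r' is R-related to the entry of r directly above it.
ColRel : (ℕ → ℕ → Set) → List ℕ → List ℕ → Set
ColRel R _        []       = ⊤
ColRel R []       (_ ∷ _)  = ⊥
ColRel R (a ∷ as) (b ∷ bs) = R a b × ColRel R as bs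

count : ℕ → List ℕ → ℕ
count x []       = 0
count x (y ∷ ys) with x ≟ y
... | yes _ = suc (count x ys)
... | no  _ = count x ys

oneTo : ℕ → List ℕ
oneTo n = map suc (upTo n)

IsSYT : ℕ → List ℕ → Tableau → Set
IsSYT n λ' T =
  shape T ≡ λ' × (concat T ↭ oneTo n) ×
  All (Linked _<_) T × Linked (ColRel _<_) T

IsSSYT : Tableau → Set
IsSSYT T = All (Linked _≤_) T × Linked (ColRel _<_) T

content : ℕ → List ℕ → List ℕ
content k xs = map (λ i → count i xs) (oneTo k)

words : ℕ → ℕ → List (List ℕ)
words zero    k = [ [] ]
words (suc m) k = concatMap (λ i → map (i ∷_) (words m k)) (oneTo k)

fillings : List ℕ → ℕ → List Tableau
fillings []         k = [ [] ]
fillings (r ∷ rows) k =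
  concatMap (λ w → map (w ∷_) (fillings rows k)) (words r k)

colRel? : {R : ℕ → ℕ → Set} → (∀ a b → Dec (R a b)) → ∀ r r' → Dec (ColRel R r r')
colRel? R? _        []       = yes tt
colRel? R? []       (_ ∷ _)  = no (λ ())
colRel? R? (a ∷ as) (b ∷ bs) = R? a b ×-dec colRel? R? as bs

all? : {P : List ℕ → Set} → (∀ r → Dec (P r)) → ∀ T → Dec (All P T)
all? P? [] = yes All.[]
all? P? (r ∷ rs) with P? r | all? P? rs
... | yes p | yes ps = yes (p All.∷ ps)
... | no ¬p | _      = no (λ { (p All.∷ _) → ¬p p })
... | _     | no ¬ps = no (λ { (_ All.∷ ps) → ¬ps ps })

isSSYT? : Decidable IsSSYT
isSSYT? T = all? (linked? _≤?_) T ×-dec linked? (colRel? _<?_) T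

-- K_{λμ}: number of SSYT of shape λ' in which i appears μ_i times
-- (entries range over 1..ℓ(μ))
kostka : List ℕ → List ℕ → ℕ
kostka λ' μ =
  length (filter (λ T → isSSYT? T ×-dec ≡-dec _≟_ (content (length μ) (concat T)) μ)
                 (fillings λ' (length μ)))

multinomial : List ℕ → ℕ
multinomial []       = 1
multinomial (m ∷ ms) = ((m + sum ms) C m) * multinomial ms

-- The deck consists of cards 1..n (top to bottom).  Cutting into piles of
-- sizes μ₁, μ₂, ... puts cards  off(i)+1, ..., off(i)+μᵢ  in pile i,
-- where off(i) = μ₁ + ... + μ_{i-1}.  An interleaving of the piles is
-- encoded by the word w (letters 1..ℓ(μ)) with content μ, where w_j is the
-- pile from which the j-th card of the new deck is taken.

-- offset of pile i (piles numbered from 1)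
offset : List ℕ → ℕ → ℕ
offset []       _             = 0
offset (m ∷ ms) zero          = 0
offset (m ∷ ms) (suc zero)    = 0
offset (m ∷ ms) (suc (suc i)) = m + offset ms (suc i)

-- the resulting deck, top to bottom; `used` = list of already used letters
deckGo : List ℕ → List ℕ → List ℕ → List ℕ
deckGo μ used []      = []
deckGo μ used (i ∷ w) = (offset μ i + count i used + 1) ∷ deckGo μ (i ∷ used) w

deck : List ℕ → List ℕ → List ℕ
deck μ w = deckGo μ [] w

interleavings : List ℕ → List (List ℕ)
interleavings μ =
  filter (λ w → ≡-dec _≟_ (content (length μ) w) μ) (words (sum μ) (length μ))

insertRow : ℕ → List ℕ → Maybe ℕ × List ℕ
insertRow x []       = nothing , [ x ]
insertRow x (y ∷ ys) with x <ᵇ y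
... | true  = just y , x ∷ ys
... | false = let (b , ys') = insertRow x ys in b , y ∷ ys'

-- Schensted insertion; also returns the index (from 0) of the row where
-- the new box was created
insertT : ℕ → Tableau → Tableau × ℕ
insertT x []       = [ [ x ] ] , 0
insertT x (r ∷ rs) with insertRow x r
... | nothing , r' = r' ∷ rs , 0
... | just y  , r' = let (rs' , i) = insertT y rs in r' ∷ rs' , suc i

-- append k at the end of row i (creating a new row if i = number of rows)
addAt : ℕ → ℕ → Tableau → Tableau
addAt k _       []       = [ [ k ] ]
addAt k zero    (r ∷ rs) = (r ++ [ k ]) ∷ rs
addAt k (suc i) (r ∷ rs) = r ∷ addAt k i rs

rskGo : ℕ → Tableau → Tableau → List ℕ → Tableau × Tableau
rskGo s P Q []      = P , Q
rskGo s P Q (x ∷ w) =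
  let (P' , i) = insertT x P in rskGo (suc s) P' (addAt (suc s) i Q) w

-- RSK recording tableau of a permutation in one-line notation σ(1)…σ(n)
recordingTableau : List ℕ → Tableau
recordingTableau σ = proj₂ (rskGo 0 [] [] σ)

-- a / b as a rational number (b = 0 is never used below)
_÷ℕ_ : ℕ → ℕ → ℚ
a ÷ℕ zero  = 0ℚ
a ÷ℕ suc b = (+ a) / suc b

tableau? : (S T : Tableau) → Dec (S ≡ T)
tableau? = ≡-dec (≡-dec _≟_)

shuffleProb : List ℕ → Tableau → ℚ
shuffleProb μ T =
  length (filter (λ w → tableau? (recordingTableau (deck μ w)) T) (interleavings μ))
  ÷ℕ length (interleavings μ)

module Submission where

-- A μ shuffle is encoded by the word w recording, for each position of the new deck, the pile
-- its card comes from. The resulting permutation is the standardisation of w (cards of one pile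
-- keep their relative order), and Schensted insertion commutes with destandardisation, so the
-- permutation and w have the same recording tableau. RSK is a bijection between words and pairs
-- (P , Q) of a semistandard tableau with the content of the word and a standard tableau of the same
-- shape. Hence the interleavings whose permutation is recorded by T correspond to the
-- semistandard tableaux of shape λ and content μ, of which there are K_{λμ}, among the
-- multinomial(μ) interleavings.

open import Defs
open import Data.Bool using (Bool; true; false; if_then_else_; T)
open import Data.Empty using (⊥)
open import Data.List
  using ( List; []; _∷_; _++_; _∷ʳ_; [_]; length; map; concat; concatMap; filter; upTo; applyUpTo
        ; head; initLast; _∷ʳ′_; cartesianProductWith; cartesianProduct)
open import Data.List.Membership.Propositional using (_∈_; _∉_)
open import Data.List.Membership.Propositional.Properties
  using ( ∈-++⁺ˡ; ∈-++⁺ʳ; ∈-++⁻; ∈-map⁺; ∈-map⁻; ∈-upTo⁺; ∈-upTo⁻; ∈-filter⁺; ∈-filter⁻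
        ; ∈-cartesianProductWith⁺; ∈-cartesianProductWith⁻; ∈-cartesianProduct⁺; ∈-cartesianProduct⁻)
open import Data.List.Membership.Propositional.Properties.WithK using (unique∧set⇒bag)
open import Data.List.Properties
  using ( ≡-dec; length-++; length-map; ++-assoc; ++-identityʳ; upTo-∷ʳ; map-++; map-∘; map-cong
        ; map-id-local; map-applyUpTo; ∷-injective; ∷-injectiveˡ; ∷-injectiveʳ
        ; filter-++; filter-none; filter-≐; filter-accept; filter-reject)
open import Data.List.Relation.Binary.BagAndSetEquality using (∼bag⇒↭)
open import Data.List.Relation.Binary.Permutation.Propositional
  using (_↭_; ↭-refl; ↭-sym; ↭-trans; ↭-reflexive; prep; swap)
open import Data.List.Relation.Binary.Permutation.Propositional.Properties
  using (shift; ++⁺ˡ; ++⁺ʳ; ∈-resp-↭; All-resp-↭; ↭-length; ∷↭∷ʳ; drop-∷; ¬x∷xs↭[]; filter-↭)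
open import Data.List.Relation.Unary.All as All using (All; []; _∷_)
open import Data.List.Relation.Unary.All.Properties
  using (All¬⇒¬Any; ∷ʳ⁺; ∷ʳ⁻; ++⁻ˡ; ++⁻ʳ; concat⁺; concat⁻)
open import Data.List.Relation.Unary.AllPairs using (AllPairs; []; _∷_)
open import Data.List.Relation.Unary.Any using (Any; here; there)
open import Data.List.Relation.Unary.Linked as Linked using (Linked; []; [-]; _∷_; _∷′_; head′)
open import Data.List.Relation.Unary.Linked.Properties using (Linked⇒All)
open import Data.List.Relation.Unary.Unique.Propositional using (Unique)
import Data.List.Relation.Unary.Unique.Propositional.Properties as Unique
open import Data.List.Reverse using (Reverse; []; _∶_∶ʳ_; reverseView)
open import Data.Maybe as Maybe using (Maybe; just; nothing)
open import Data.Maybe.Relation.Binary.Connected using (Connected; just; just-nothing)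
open import Data.Nat
  using (ℕ; zero; suc; pred; _+_; _*_; _∸_; _<_; _≤_; _<ᵇ_; _≟_; _<?_; _≤?_; z≤n; s≤s)
open import Data.List.Membership.DecPropositional _≟_ using (_∈?_)
open import Data.Nat.Combinatorics using (_C_; nCk+nC[k+1]≡[n+1]C[k+1])
open import Data.Nat.ListAction using (sum)
open import Data.Nat.Properties
open import Data.Product as Product using (_×_; _,_; proj₁; proj₂; map₁; map₂; uncurry; ∃)
open import Data.Sum using (inj₁; inj₂)
open import Data.Unit using (⊤; tt)
open import Function using (case_of_; id; _∘_)
open import Function.Bundles using (mk⇔)
open import Relation.Nullary using (Dec; yes; no; does; contradiction; _×-dec_)
open import Relation.Nullary.Reflects using (ofʸ; ofⁿ)
open import Relation.Binary.PropositionalEquality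
  using (_≡_; _≢_; refl; sym; trans; cong; cong₂; subst; module ≡-Reasoning)

-- Schensted insertion

length-∷ʳ : ∀ (r : List ℕ) x → length (r ∷ʳ x) ≡ suc (length r)
length-∷ʳ r x = trans (length-++ r) (+-comm (length r) 1)

data RowInsertion (x : ℕ) : List ℕ → Maybe ℕ × List ℕ → Set where
  append : RowInsertion x [] (nothing , [ x ])
  bump   : ∀ {y ys} → x < y → RowInsertion x (y ∷ ys) (just y , x ∷ ys)
  skip   : ∀ {y ys o ys′} → y ≤ x → RowInsertion x ys (o , ys′) →
           RowInsertion x (y ∷ ys) (o , y ∷ ys′)

insertRow-view : ∀ x r → RowInsertion x r (insertRow x r)
insertRow-view x []       = append
insertRow-view x (y ∷ ys) with x <ᵇ y | <ᵇ-reflects-< x y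
... | true  | ofʸ x<y = bump x<y
... | false | ofⁿ x≮y = skip (≮⇒≥ x≮y) (insertRow-view x ys)

RowInsertion-functional : ∀ {x r o o′} →
                          RowInsertion x r o → RowInsertion x r o′ → o ≡ o′
RowInsertion-functional append       append       = refl
RowInsertion-functional (bump _)     (bump _)     = refl
RowInsertion-functional (bump x<y)   (skip y≤x _) = contradiction x<y (≤⇒≯ y≤x)
RowInsertion-functional (skip y≤x _) (bump x<y)   = contradiction x<y (≤⇒≯ y≤x)
RowInsertion-functional (skip _ ins) (skip _ ins′)
  with refl ← RowInsertion-functional ins ins′ = refl

-- The index is the row, counted from 0, in which the new box appears.
data Insertion (x : ℕ) : Tableau → Tableau × ℕ → Set where
  newRow   : Insertion x [] ([ [ x ] ] , 0)
  settle   : ∀ {r r′ rs} → RowInsertion x r (nothing , r′) →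
             Insertion x (r ∷ rs) (r′ ∷ rs , 0)
  bumpDown : ∀ {r r′ rs rs′ y i} → RowInsertion x r (just y , r′) → Insertion y rs (rs′ , i) →
             Insertion x (r ∷ rs) (r′ ∷ rs′ , suc i)

insertT-view : ∀ x P → Insertion x P (insertT x P)
insertT-view x []       = newRow
insertT-view x (r ∷ rs) with insertRow x r | insertRow-view x r
... | nothing , r′ | ins = settle ins
... | just y  , r′ | ins = bumpDown ins (insertT-view y rs)

Insertion-functional : ∀ {x P o o′} → Insertion x P o → Insertion x P o′ → o ≡ o′
Insertion-functional newRow newRow = refl
Insertion-functional (settle ins) (settle ins′)
  with refl ← RowInsertion-functional ins ins′ = refl
Insertion-functional (settle ins) (bumpDown ins′ _)
  with () ← RowInsertion-functional ins ins′
Insertion-functional (bumpDown ins _) (settle ins′)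
  with () ← RowInsertion-functional ins ins′
Insertion-functional (bumpDown ins t) (bumpDown ins′ t′)
  with refl ← RowInsertion-functional ins ins′
  with refl ← Insertion-functional t t′ = refl

Insertion⇒insertT : ∀ {x P o} → Insertion x P o → insertT x P ≡ o
Insertion⇒insertT {x} {P} = Insertion-functional (insertT-view x P)

bumped>inserted : ∀ {x r y r′} → RowInsertion x r (just y , r′) → x < y
bumped>inserted (bump x<y)   = x<y
bumped>inserted (skip _ ins) = bumped>inserted ins

bumped∈row : ∀ {x r y r′} → RowInsertion x r (just y , r′) → y ∈ r
bumped∈row (bump _)     = here refl
bumped∈row (skip _ ins) = there (bumped∈row ins)

inserted∈row : ∀ {x r o r′} → RowInsertion x r (o , r′) → x ∈ r′
inserted∈row append       = here refl
inserted∈row (bump _)     = here refl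
inserted∈row (skip _ ins) = there (inserted∈row ins)

RowInsertion-append : ∀ {x r r′} → RowInsertion x r (nothing , r′) → r′ ≡ r ∷ʳ x
RowInsertion-append append       = refl
RowInsertion-append (skip _ ins) = cong (_ ∷_) (RowInsertion-append ins)

append-RowInsertion : ∀ {x r} → All (_≤ x) r → RowInsertion x r (nothing , r ∷ʳ x)
append-RowInsertion []         = append
append-RowInsertion (y≤x ∷ ys) = skip y≤x (append-RowInsertion ys)

RowInsertion-bump-↭ : ∀ {x r y r′} → RowInsertion x r (just y , r′) → y ∷ r′ ↭ x ∷ r
RowInsertion-bump-↭ {x} (bump {y} _) = swap y x ↭-refl
RowInsertion-bump-↭ {x} (skip {c} {o = just y} _ ins) =
  ↭-trans (swap y c ↭-refl) (↭-trans (prep c (RowInsertion-bump-↭ ins)) (swap c x ↭-refl))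

RowInsertion-append-↭ : ∀ {x r r′} → RowInsertion x r (nothing , r′) → r′ ↭ x ∷ r
RowInsertion-append-↭ {x} {r} ins rewrite RowInsertion-append ins = ↭-sym (∷↭∷ʳ x r)

RowInsertion-bump-length : ∀ {x r y r′} → RowInsertion x r (just y , r′) →
                           length r′ ≡ length r
RowInsertion-bump-length (bump _)     = refl
RowInsertion-bump-length (skip _ ins) = cong suc (RowInsertion-bump-length ins)

RowInsertion-append-length : ∀ {x r r′} → RowInsertion x r (nothing , r′) →
                             length r′ ≡ suc (length r)
RowInsertion-append-length {x} {r} ins rewrite RowInsertion-append ins = length-∷ʳ r x

RowInsertion-head : ∀ {x r o r′ z} → RowInsertion x r (o , r′) → z ≤ x →
                    Connected _≤_ (just z) (head r) → Connected _≤_ (just z) (head r′)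
RowInsertion-head append     z≤x _ = just z≤x
RowInsertion-head (bump _)   z≤x _ = just z≤x
RowInsertion-head (skip _ _) _   c = c

RowInsertion-sorted : ∀ {x r o r′} → RowInsertion x r (o , r′) → Linked _≤_ r → Linked _≤_ r′
RowInsertion-sorted append                  _                = [-]
RowInsertion-sorted (bump {ys = []} _)      _                = [-]
RowInsertion-sorted (bump {ys = _ ∷ _} x<y) (y≤c ∷ sorted)   = ≤-trans (<⇒≤ x<y) y≤c ∷ sorted
RowInsertion-sorted (skip y≤x ins)          sorted           =
  RowInsertion-head ins y≤x (head′ sorted) ∷′ RowInsertion-sorted ins (Linked.tail sorted)

ColRel-prefix : ∀ {R : ℕ → ℕ → Set} a (b c : List ℕ) → ColRel R a (b ++ c) → ColRel R a b
ColRel-prefix _       []      _ _       = tt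
ColRel-prefix (_ ∷ a) (_ ∷ b) c (p , h) = p , ColRel-prefix a b c h

ColRel-++ : ∀ {R : ℕ → ℕ → Set} (a c b : List ℕ) → ColRel R a b → ColRel R (a ++ c) b
ColRel-++ a       c []      _       = tt
ColRel-++ (_ ∷ a) c (_ ∷ b) (p , h) = p , ColRel-++ a c b h

-- Bumping only decreases entries of the upper row.
ColRel-bumpAbove : ∀ {x a y a′ b} → RowInsertion x a (just y , a′) →
                   ColRel _<_ a b → ColRel _<_ a′ b
ColRel-bumpAbove {b = []}    _            _         = tt
ColRel-bumpAbove {b = _ ∷ _} (bump x<y)   (y<c , h) = <-trans x<y y<c , h
ColRel-bumpAbove {b = _ ∷ _} (skip _ ins) (p , h)   = p , ColRel-bumpAbove ins h

ColRel-bumpInto : ∀ {x a y a′ b o b′} →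
                  RowInsertion x a (just y , a′) → RowInsertion y b (o , b′) →
                  ColRel _<_ a b → ColRel _<_ a′ b′
ColRel-bumpInto (bump x<y)     append       _         = x<y , tt
ColRel-bumpInto (bump x<y)     (bump _)     (_ , h)   = x<y , h
ColRel-bumpInto (bump _)       (skip c≤y _) (y<c , _) = contradiction y<c (≤⇒≯ c≤y)
ColRel-bumpInto (skip c≤x ins) append       _         = ≤-<-trans c≤x (bumped>inserted ins) , tt
ColRel-bumpInto (skip c≤x ins) (bump _)     (_ , h)   =
  ≤-<-trans c≤x (bumped>inserted ins) , ColRel-bumpAbove ins h
ColRel-bumpInto (skip _ ins)   (skip _ ins′) (p , h)  = p , ColRel-bumpInto ins ins′ h

addBox : ℕ → List ℕ → List ℕ
addBox _       []       = [ 1 ]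
addBox zero    (a ∷ as) = suc a ∷ as
addBox (suc i) (a ∷ as) = a ∷ addBox i as

Insertion-↭ : ∀ {x P P′ i} → Insertion x P (P′ , i) → concat P′ ↭ x ∷ concat P
Insertion-↭ newRow                 = ↭-refl
Insertion-↭ (settle {rs = rs} ins) = ++⁺ʳ (concat rs) (RowInsertion-append-↭ ins)
Insertion-↭ (bumpDown {r′ = r′} {rs} {y = y} ins t) =
  ↭-trans (++⁺ˡ r′ (Insertion-↭ t))
          (↭-trans (shift y r′ (concat rs)) (++⁺ʳ (concat rs) (RowInsertion-bump-↭ ins)))

Insertion-shape : ∀ {x P P′ i} → Insertion x P (P′ , i) → shape P′ ≡ addBox i (shape P)
Insertion-shape newRow           = refl
Insertion-shape (settle ins)     = cong (_∷ _) (RowInsertion-append-length ins)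
Insertion-shape (bumpDown ins t) = cong₂ _∷_ (RowInsertion-bump-length ins) (Insertion-shape t)

Insertion-index≤ : ∀ {x P P′ i} → Insertion x P (P′ , i) → i ≤ length P
Insertion-index≤ newRow         = z≤n
Insertion-index≤ (settle _)     = z≤n
Insertion-index≤ (bumpDown _ t) = s≤s (Insertion-index≤ t)

Insertion-rows : ∀ {x P P′ i} → Insertion x P (P′ , i) →
                 All (Linked _≤_) P → All (Linked _≤_) P′
Insertion-rows newRow           _        = [-] ∷ []
Insertion-rows (settle ins)     (s ∷ ss) = RowInsertion-sorted ins s ∷ ss
Insertion-rows (bumpDown ins t) (s ∷ ss) = RowInsertion-sorted ins s ∷ Insertion-rows t ss

Insertion-columns : ∀ {x P P′ i} → Insertion x P (P′ , i) →
                    Linked (ColRel _<_) P → Linked (ColRel _<_) P′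
Insertion-columns newRow _ = [-]
Insertion-columns {x} (settle {r} {rs = rs} ins) cols rewrite RowInsertion-append ins =
  extend rs (head′ cols) ∷′ Linked.tail cols
  where
  extend : ∀ rs → Connected (ColRel _<_) (just r) (head rs) →
           Connected (ColRel _<_) (just (r ∷ʳ x)) (head rs)
  extend []      _        = just-nothing
  extend (b ∷ _) (just h) = just (ColRel-++ r [ x ] b h)
Insertion-columns (bumpDown ins t) cols =
  below ins t (head′ cols) ∷′ Insertion-columns t (Linked.tail cols)
  where
  below : ∀ {x a y a′ rs rs′ j} → RowInsertion x a (just y , a′) → Insertion y rs (rs′ , j) →
          Connected (ColRel _<_) (just a) (head rs) → Connected (ColRel _<_) (just a′) (head rs′)
  below ins newRow            _        = just (ColRel-bumpInto ins append tt)
  below ins (settle ins′)     (just h) = just (ColRel-bumpInto ins ins′ h)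
  below ins (bumpDown ins′ _) (just h) = just (ColRel-bumpInto ins ins′ h)

Insertion-SSYT : ∀ {x P P′ i} → Insertion x P (P′ , i) → IsSSYT P → IsSSYT P′
Insertion-SSYT t (rows , cols) = Insertion-rows t rows , Insertion-columns t cols

-- Reverse insertion

<ᵇ-true : ∀ {m n} → m < n → (m <ᵇ n) ≡ true
<ᵇ-true {m} {n} m<n with m <ᵇ n | <ᵇ-reflects-< m n
... | true  | _       = refl
... | false | ofⁿ m≮n = contradiction m<n m≮n

<ᵇ-false : ∀ {m n} → n ≤ m → (m <ᵇ n) ≡ false
<ᵇ-false {m} {n} n≤m with m <ᵇ n | <ᵇ-reflects-< m n
... | true  | ofʸ m<n = contradiction m<n (≤⇒≯ n≤m)
... | false | _       = refl

Linked-headAll : ∀ {R : ℕ → ℕ → Set} → (∀ {a b c} → R a b → R b c → R a c) →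
                 ∀ {x xs} → Linked R (x ∷ xs) → All (R x) xs
Linked-headAll trans [-]         = []
Linked-headAll trans (Rxy ∷ Rys) = Linked⇒All trans Rxy Rys

head≤tail : ∀ {x xs} → Linked _≤_ (x ∷ xs) → All (x ≤_) xs
head≤tail = Linked-headAll ≤-trans

startsBelow : ℕ → List ℕ → Bool
startsBelow y []      = false
startsBelow y (b ∷ _) = b <ᵇ y

startsBelow-true : ∀ {y} as → startsBelow y as ≡ true → Any (_< y) as
startsBelow-true {y} (b ∷ _) b<ᵇy = here (<ᵇ⇒< b y (subst T (sym b<ᵇy) tt))

startsBelow-false : ∀ {y} as → startsBelow y as ≡ false → Connected _≤_ (just y) (head as)
startsBelow-false     []      _    = just-nothing
startsBelow-false {y} (b ∷ _) b≮ᵇy = just (≮⇒≥ (λ b<y → subst T b≮ᵇy (<⇒<ᵇ b<y)))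

startsBelow-bump : ∀ {x r y r′} → RowInsertion x r (just y , r′) → startsBelow y r′ ≡ true
startsBelow-bump (bump x<y)     = <ᵇ-true x<y
startsBelow-bump (skip c≤x ins) = <ᵇ-true (≤-<-trans c≤x (bumped>inserted ins))

-- y replaces the rightmost entry smaller than y, which is pushed out.
unbumpRow : ℕ → List ℕ → ℕ × List ℕ
unbumpRow y []       = y , []
unbumpRow y (a ∷ as) =
  if a <ᵇ y
  then (if startsBelow y as then map₂ (a ∷_) (unbumpRow y as) else (a , y ∷ as))
  else (y , a ∷ as)

unbumpRow-bump : ∀ {x r y r′} → RowInsertion x r (just y , r′) → Linked _≤_ r →
                 unbumpRow y r′ ≡ (x , r)
unbumpRow-bump (bump {ys = []} x<y)    _         rewrite <ᵇ-true x<y = refl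
unbumpRow-bump (bump {ys = _ ∷ _} x<y) (y≤c ∷ _) rewrite <ᵇ-true x<y | <ᵇ-false y≤c = refl
unbumpRow-bump (skip c≤x ins)          sorted
  rewrite <ᵇ-true (≤-<-trans c≤x (bumped>inserted ins)) | startsBelow-bump ins
        | unbumpRow-bump ins (Linked.tail sorted) = refl

unbumpRow-head : ∀ {z r′ y r a} → RowInsertion z r′ (just y , r) → a ≤ y →
                 Connected _≤_ (just a) (head r) → Connected _≤_ (just a) (head r′)
unbumpRow-head (bump _)   a≤y _ = just a≤y
unbumpRow-head (skip _ _) _   c = c

unbumpRow-correct : ∀ y r → Linked _≤_ r → Any (_< y) r →
                    let (z , r′) = unbumpRow y r in RowInsertion z r′ (just y , r) × Linked _≤_ r′
unbumpRow-correct y (a ∷ as) sorted below with a <ᵇ y | <ᵇ-reflects-< a y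
... | false | ofⁿ a≮y =
  contradiction below
    (All¬⇒¬Any (All.map (λ a≤c c<y → a≮y (≤-<-trans a≤c c<y)) (Linked⇒All ≤-trans ≤-refl sorted)))
... | true | ofʸ a<y with startsBelow y as in below?
...   | false = bump a<y , startsBelow-false as below? ∷′ Linked.tail sorted
...   | true  with unbumpRow-correct y as (Linked.tail sorted) (startsBelow-true as below?)
...     | ins , sorted′ =
  skip (All.lookup (head≤tail sorted) (inserted∈row ins)) ins ,
  unbumpRow-head ins (<⇒≤ a<y) (head′ sorted) ∷′ sorted′

RowsNonEmpty : Tableau → Set
RowsNonEmpty T = All (0 <_) (shape T)

popLast : List ℕ → ℕ × List ℕ
popLast []           = 0 , []
popLast (a ∷ [])     = a , []
popLast (a ∷ b ∷ bs) = map₂ (a ∷_) (popLast (b ∷ bs))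

popLast-∷ʳ : ∀ r x → popLast (r ∷ʳ x) ≡ (x , r)
popLast-∷ʳ []          x = refl
popLast-∷ʳ (a ∷ [])    x = refl
popLast-∷ʳ (a ∷ b ∷ r) x rewrite popLast-∷ʳ (b ∷ r) x = refl

consRow : List ℕ → Tableau → Tableau
consRow []       rs = rs
consRow (a ∷ as) rs = (a ∷ as) ∷ rs

consRow-nonEmpty : ∀ r rs → 0 < length r → consRow r rs ≡ r ∷ rs
consRow-nonEmpty (_ ∷ _) rs _ = refl

removeBox : ℕ → Tableau → Tableau
removeBox _       []       = []
removeBox zero    (r ∷ rs) = consRow (proj₂ (popLast r)) rs
removeBox (suc i) (r ∷ rs) = r ∷ removeBox i rs

-- Reverse Schensted insertion, starting from the last box of row i.
uninsert : ℕ → Tableau → ℕ × Tableau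
uninsert _       []       = 0 , []
uninsert zero    (r ∷ rs) = proj₁ (popLast r) , removeBox zero (r ∷ rs)
uninsert (suc i) (r ∷ rs) =
  let (y , rs′) = uninsert i rs ; (x , r′) = unbumpRow y r in x , r′ ∷ rs′

uninsert-insert : ∀ {x P P′ i} → Insertion x P (P′ , i) → All (Linked _≤_) P → RowsNonEmpty P →
                  uninsert i P′ ≡ (x , P)
uninsert-insert newRow _ _ = refl
uninsert-insert {x} (settle {r} {rs = rs} ins) _ (r≢[] ∷ _)
  rewrite RowInsertion-append ins | popLast-∷ʳ r x = cong (x ,_) (consRow-nonEmpty r rs r≢[])
uninsert-insert (bumpDown ins t) (sorted ∷ rows) (_ ∷ nonEmpty)
  rewrite uninsert-insert t rows nonEmpty | unbumpRow-bump ins sorted = refl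

IsCorner : ℕ → List ℕ → Set
IsCorner _       []          = ⊥
IsCorner zero    (a ∷ [])    = ⊤
IsCorner zero    (a ∷ b ∷ _) = b < a
IsCorner (suc i) (a ∷ as)    = IsCorner i as

ColRel⇒Any : ∀ {a b x} → ColRel _<_ a b → x ∈ b → Any (_< x) a
ColRel⇒Any {[]}    {_ ∷ _} ()
ColRel⇒Any {_ ∷ _} {_ ∷ _} (p , _) (here refl) = here p
ColRel⇒Any {_ ∷ _} {_ ∷ _} (_ , h) (there x∈b) = there (ColRel⇒Any h x∈b)

-- y lands in the row below r, so strictly below some entry of r.
Insertion-below : ∀ {y rs rs′ j r} → Insertion y rs (rs′ , j) →
                  Connected (ColRel _<_) (just r) (head rs′) → Any (_< y) r
Insertion-below {r = []}    newRow           (just ())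
Insertion-below {r = _ ∷ _} newRow           (just (p , _)) = here p
Insertion-below             (settle ins)     (just h)       = ColRel⇒Any h (inserted∈row ins)
Insertion-below             (bumpDown ins _) (just h)       = ColRel⇒Any h (inserted∈row ins)

ColRel-unbumpAbove : ∀ {z as′ y as cs} → RowInsertion z as′ (just y , as) →
                     ColRel _<_ as cs → All (y <_) cs → ColRel _<_ as′ cs
ColRel-unbumpAbove {cs = []}    _            _       _          = tt
ColRel-unbumpAbove {cs = _ ∷ _} (bump _)     (_ , h) (y<c ∷ _)  = y<c , h
ColRel-unbumpAbove {cs = _ ∷ _} (skip _ ins) (p , h) (_ ∷ y<cs) = p , ColRel-unbumpAbove ins h y<cs

ColRel-unbump : ∀ {z r′ y r b′ o b} → RowInsertion z r′ (just y , r) → RowInsertion y b′ (o , b) →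
                ColRel _<_ r b → Linked _≤_ r′ → Linked _≤_ b′ → ColRel _<_ r′ b′
ColRel-unbump _ append _ _ _ = tt
ColRel-unbump (bump _) (bump y<c) (_ , h) _ _ = y<c , h
ColRel-unbump (bump _) (skip _ ins) (_ , h) sorted _ =
  contradiction (ColRel⇒Any h (inserted∈row ins)) (All¬⇒¬Any (All.map ≤⇒≯ (head≤tail sorted)))
ColRel-unbump (skip a≤z ins) (bump y<c) (_ , h) _ sorted′ =
  <-trans (≤-<-trans a≤z (bumped>inserted ins)) y<c ,
  ColRel-unbumpAbove ins h (All.map (<-≤-trans y<c) (head≤tail sorted′))
ColRel-unbump (skip _ ins) (skip _ ins′) (p , h) sorted sorted′ =
  p , ColRel-unbump ins ins′ h (Linked.tail sorted) (Linked.tail sorted′)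

Linked-∷ʳ⁻ : ∀ {R : ℕ → ℕ → Set} r₀ z → Linked R (r₀ ∷ʳ z) → Linked R r₀
Linked-∷ʳ⁻ []           _ _        = []
Linked-∷ʳ⁻ (_ ∷ [])     _ _        = [-]
Linked-∷ʳ⁻ (_ ∷ b ∷ r₀) z (p ∷ ps) = p ∷ Linked-∷ʳ⁻ (b ∷ r₀) z ps

sorted-∷ʳ⇒≤last : ∀ r₀ z → Linked _≤_ (r₀ ∷ʳ z) → All (_≤ z) r₀
sorted-∷ʳ⇒≤last []       _ _      = []
sorted-∷ʳ⇒≤last (_ ∷ r₀) z sorted =
  proj₂ (∷ʳ⁻ (head≤tail sorted)) ∷ sorted-∷ʳ⇒≤last r₀ z (Linked.tail sorted)

ColRel-∷ʳ⁻ : ∀ {R : ℕ → ℕ → Set} r₀ z b → ColRel R (r₀ ∷ʳ z) b → length b ≤ length r₀ →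
             ColRel R r₀ b
ColRel-∷ʳ⁻ _        _ []      _       _       = tt
ColRel-∷ʳ⁻ (_ ∷ r₀) z (_ ∷ b) (p , h) (s≤s l) = p , ColRel-∷ʳ⁻ r₀ z b h l

corner-below : ∀ {R : ℕ → ℕ → Set} r₀ z rs → IsCorner zero (shape ((r₀ ∷ʳ z) ∷ rs)) →
               Connected (ColRel R) (just (r₀ ∷ʳ z)) (head rs) →
               Connected (ColRel R) (just r₀) (head rs)
corner-below r₀ z []      _      _        = just-nothing
corner-below r₀ z (b ∷ _) corner (just h) =
  just (ColRel-∷ʳ⁻ r₀ z b h (≤-pred (subst (length b <_) (length-∷ʳ r₀ z) corner)))

uninsert-correct : ∀ i S → IsSSYT S → RowsNonEmpty S → IsCorner i (shape S) →
                   let (x , S′) = uninsert i S in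
                   Insertion x S′ (S , i) × IsSSYT S′ × RowsNonEmpty S′
uninsert-correct zero (r ∷ rs) (sorted ∷ rows , cols) (_ ∷ nonEmpty) corner with initLast r
... | r₀ ∷ʳ′ z rewrite popLast-∷ʳ r₀ z with r₀ | rs
...   | []      | []          = newRow , ([] , []) , []
...   | []      | (_ ∷ _) ∷ _ with s≤s () ← corner
...   | []      | [] ∷ _      with () ∷ _ ← nonEmpty
...   | a ∷ r₀′ | rs          =
  settle (append-RowInsertion (sorted-∷ʳ⇒≤last (a ∷ r₀′) z sorted)) ,
  (Linked-∷ʳ⁻ (a ∷ r₀′) z sorted ∷ rows ,
   corner-below (a ∷ r₀′) z rs corner (head′ cols) ∷′ Linked.tail cols) ,
  s≤s z≤n ∷ nonEmpty
uninsert-correct (suc i) (r ∷ rs@(_ ∷ _)) (sorted ∷ rows , cols) (r≢[] ∷ nonEmpty) corner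
  with uninsert i rs | uninsert-correct i rs (rows , Linked.tail cols) nonEmpty corner
... | y , rs′ | t , (rows′ , cols′) , nonEmpty′
  with unbumpRow y r | unbumpRow-correct y r sorted (Insertion-below t (head′ cols))
... | x , r′ | ins , sorted′ =
  bumpDown ins t ,
  (sorted′ ∷ rows′ , above ins t (head′ cols) sorted′ rows′ ∷′ cols′) ,
  subst (0 <_) (RowInsertion-bump-length ins) r≢[] ∷ nonEmpty′
  where
  above : ∀ {x r′ y r rs′ rs j} → RowInsertion x r′ (just y , r) → Insertion y rs′ (rs , j) →
          Connected (ColRel _<_) (just r) (head rs) → Linked _≤_ r′ → All (Linked _≤_) rs′ →
          Connected (ColRel _<_) (just r′) (head rs′)
  above ins newRow            _        _ _ = just-nothing
  above ins (settle ins′)     (just h) s (s′ ∷ _) = just (ColRel-unbump ins ins′ h s s′)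
  above ins (bumpDown ins′ _) (just h) s (s′ ∷ _) = just (ColRel-unbump ins ins′ h s s′)

rowOf : ℕ → Tableau → ℕ
rowOf k []       = 0
rowOf k (r ∷ rs) with k ∈? r
... | yes _ = 0
... | no  _ = suc (rowOf k rs)

rowOf-addAt : ∀ k i Q → k ∉ concat Q → i ≤ length Q → rowOf k (addAt k i Q) ≡ i
rowOf-addAt k _ [] _ z≤n with k ∈? [ k ]
... | yes _   = refl
... | no  k∉k = contradiction (here refl) k∉k
rowOf-addAt k zero (r ∷ rs) _ _ with k ∈? r ∷ʳ k
... | yes _   = refl
... | no  k∉r = contradiction (∈-++⁺ʳ r (here refl)) k∉r
rowOf-addAt k (suc i) (r ∷ rs) k∉Q (s≤s i≤) with k ∈? r
... | yes k∈r = contradiction (∈-++⁺ˡ k∈r) k∉Q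
... | no  _   = cong suc (rowOf-addAt k i rs (k∉Q ∘ ∈-++⁺ʳ r) i≤)

removeBox-addAt : ∀ k i Q → RowsNonEmpty Q → i ≤ length Q → removeBox i (addAt k i Q) ≡ Q
removeBox-addAt k _       []       _              z≤n     = refl
removeBox-addAt k zero    (r ∷ rs) (r≢[] ∷ _)     _       rewrite popLast-∷ʳ r k =
  consRow-nonEmpty r rs r≢[]
removeBox-addAt k (suc i) (r ∷ rs) (_ ∷ nonEmpty) (s≤s l) =
  cong (r ∷_) (removeBox-addAt k i rs nonEmpty l)

max-last : ∀ {k} r → Linked _<_ r → All (_≤ k) r → k ∈ r → ∃ λ r₀ → r ≡ r₀ ∷ʳ k
max-last (_ ∷ [])    _         _             (here refl) = [] , refl
max-last (_ ∷ _ ∷ _) (a<b ∷ _) (_ ∷ b≤a ∷ _) (here refl) = contradiction a<b (≤⇒≯ b≤a)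
max-last (a ∷ r)     sorted    (_ ∷ ≤k)      (there k∈r)
  with max-last r (Linked.tail sorted) ≤k k∈r
... | r₀ , refl = a ∷ r₀ , refl

ColRel-below-last : ∀ {k} r₀ b → ColRel _<_ (r₀ ∷ʳ k) b → length r₀ < length b → Any (k <_) b
ColRel-below-last []       (_ ∷ _) (k<c , _) _       = here k<c
ColRel-below-last (_ ∷ r₀) (_ ∷ b) (_ , h)   (s≤s l) = there (ColRel-below-last r₀ b h l)

-- A box below the maximal entry would hold a larger entry.
max-corner : ∀ {k} r₀ rs → Linked (ColRel _<_) ((r₀ ∷ʳ k) ∷ rs) → All (_≤ k) (concat rs) →
             IsCorner zero (shape ((r₀ ∷ʳ k) ∷ rs))
max-corner     r₀ []       _       _  = tt
max-corner {k} r₀ (b ∷ bs) (h ∷ _) ≤k with length b <? length (r₀ ∷ʳ k)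
... | yes corner  = corner
... | no  ¬corner =
  contradiction (ColRel-below-last r₀ b h longer) (All¬⇒¬Any (All.map ≤⇒≯ (++⁻ˡ b ≤k)))
  where
  longer : length r₀ < length b
  longer = subst (_≤ length b) (length-∷ʳ r₀ k) (≮⇒≥ ¬corner)

record MaxRemoval (k : ℕ) (T : Tableau) (i : ℕ) (T′ : Tableau) : Set where
  field
    corner    : IsCorner i (shape T)
    readd     : addAt k i T′ ≡ T
    rows      : All (Linked _<_) T′
    columns   : Linked (ColRel _<_) T′
    nonEmpty  : RowsNonEmpty T′
    ↭-removed : concat T ↭ k ∷ concat T′
    below     : ∀ {a} → Connected (ColRel _<_) (just a) (head T) →
                Connected (ColRel _<_) (just a) (head T′)

maxRemoval-firstRow : ∀ k r₀ rs → Linked _<_ (r₀ ∷ʳ k) → All (Linked _<_) rs →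
                      Linked (ColRel _<_) ((r₀ ∷ʳ k) ∷ rs) → RowsNonEmpty rs →
                      All (_≤ k) (concat rs) → MaxRemoval k ((r₀ ∷ʳ k) ∷ rs) 0 (consRow r₀ rs)
maxRemoval-firstRow k [] [] _ _ _ _ _ = record
  { corner = tt ; readd = refl ; rows = [] ; columns = [] ; nonEmpty = []
  ; ↭-removed = ↭-refl ; below = λ _ → just-nothing }
maxRemoval-firstRow k [] ((_ ∷ _) ∷ _) _ _ cols _ ≤k with s≤s () ← max-corner [] _ cols ≤k
maxRemoval-firstRow k [] ([] ∷ _) _ _ _ (() ∷ _) _
maxRemoval-firstRow k r₀@(_ ∷ _) rs sorted rows cols nonEmpty ≤k = record
  { corner    = corner
  ; readd     = refl
  ; rows      = Linked-∷ʳ⁻ r₀ k sorted ∷ rows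
  ; columns   = corner-below r₀ k rs corner (head′ cols) ∷′ Linked.tail cols
  ; nonEmpty  = s≤s z≤n ∷ nonEmpty
  ; ↭-removed = ↭-trans (↭-reflexive (++-assoc r₀ [ k ] (concat rs))) (shift k r₀ (concat rs))
  ; below     = λ { (just h) → just (ColRel-prefix _ r₀ [ k ] h) } }
  where
  corner = max-corner r₀ rs cols ≤k

maxRemoval : ∀ k T → All (Linked _<_) T → Linked (ColRel _<_) T → RowsNonEmpty T →
             All (_≤ k) (concat T) → k ∈ concat T →
             MaxRemoval k T (rowOf k T) (removeBox (rowOf k T) T)
maxRemoval k (r ∷ rs) (sorted ∷ rows) cols (_ ∷ nonEmpty) ≤k k∈T with k ∈? r
... | yes k∈r with max-last r sorted (++⁻ˡ r ≤k) k∈r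
...   | r₀ , refl rewrite popLast-∷ʳ r₀ k =
  maxRemoval-firstRow k r₀ rs sorted rows cols nonEmpty (++⁻ʳ (r₀ ∷ʳ k) ≤k)
maxRemoval k (r ∷ rs) (sorted ∷ rows) cols (r≢[] ∷ nonEmpty) ≤k k∈T | no k∉r = record
  { corner    = MaxRemoval.corner IH
  ; readd     = cong (r ∷_) (MaxRemoval.readd IH)
  ; rows      = sorted ∷ MaxRemoval.rows IH
  ; columns   = MaxRemoval.below IH (head′ cols) ∷′ MaxRemoval.columns IH
  ; nonEmpty  = r≢[] ∷ MaxRemoval.nonEmpty IH
  ; ↭-removed = ↭-trans (++⁺ˡ r (MaxRemoval.↭-removed IH)) (shift k r _)
  ; below     = id }
  where
  k∈rs : k ∈ concat rs
  k∈rs with ∈-++⁻ r k∈T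
  ... | inj₁ k∈r  = contradiction k∈r k∉r
  ... | inj₂ k∈rs = k∈rs
  IH = maxRemoval k rs rows (Linked.tail cols) nonEmpty (++⁻ʳ r ≤k) k∈rs

-- RSK and its inverse

rsk : List ℕ → Tableau × Tableau
rsk w = rskGo 0 [] [] w

rskGo-∷ʳ : ∀ s P Q w x → rskGo s P Q (w ∷ʳ x) ≡
           (let (P′ , Q′) = rskGo s P Q w ; (P″ , i) = insertT x P′ in
            P″ , addAt (suc (s + length w)) i Q′)
rskGo-∷ʳ s P Q []      x rewrite +-identityʳ s = refl
rskGo-∷ʳ s P Q (y ∷ w) x rewrite +-suc s (length w) =
  rskGo-∷ʳ (suc s) (proj₁ (insertT y P)) (addAt (suc s) (proj₂ (insertT y P)) Q) w x

rsk-∷ʳ : ∀ w x → rsk (w ∷ʳ x) ≡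
         (let (P , Q) = rsk w ; (P′ , i) = insertT x P in P′ , addAt (suc (length w)) i Q)
rsk-∷ʳ = rskGo-∷ʳ 0 [] []

oneTo-suc-↭ : ∀ n → oneTo (suc n) ↭ suc n ∷ oneTo n
oneTo-suc-↭ n =
  ↭-trans (↭-reflexive (trans (cong (map suc) (sym (upTo-∷ʳ n))) (map-++ suc (upTo n) [ n ])))
          (↭-sym (∷↭∷ʳ (suc n) (oneTo n)))

addBox-nonEmpty : ∀ i sh → All (0 <_) sh → All (0 <_) (addBox i sh)
addBox-nonEmpty _       []       _        = s≤s z≤n ∷ []
addBox-nonEmpty zero    (_ ∷ _)  (_ ∷ ps) = s≤s z≤n ∷ ps
addBox-nonEmpty (suc i) (_ ∷ sh) (p ∷ ps) = p ∷ addBox-nonEmpty i sh ps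

addAt-shape : ∀ k i Q → shape (addAt k i Q) ≡ addBox i (shape Q)
addAt-shape k _       []      = refl
addAt-shape k zero    (r ∷ Q) = cong (_∷ _) (length-∷ʳ r k)
addAt-shape k (suc i) (r ∷ Q) = cong (_ ∷_) (addAt-shape k i Q)

addAt-↭ : ∀ k i Q → concat (addAt k i Q) ↭ k ∷ concat Q
addAt-↭ k _       []      = ↭-refl
addAt-↭ k zero    (r ∷ Q) = ↭-trans (↭-reflexive (++-assoc r [ k ] (concat Q))) (shift k r (concat Q))
addAt-↭ k (suc i) (r ∷ Q) = ↭-trans (++⁺ˡ r (addAt-↭ k i Q)) (shift k r (concat Q))

record RSKPair (w : List ℕ) (P Q : Tableau) : Set where
  field
    ssyt      : IsSSYT P
    nonEmpty  : RowsNonEmpty P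
    sameShape : shape P ≡ shape Q
    ↭-word    : concat P ↭ w
    ↭-steps   : concat Q ↭ oneTo (length w)

rsk-pair : ∀ w → RSKPair w (proj₁ (rsk w)) (proj₂ (rsk w))
rsk-pair w = go (reverseView w)
  where
  go : ∀ {w} → Reverse w → RSKPair w (proj₁ (rsk w)) (proj₂ (rsk w))
  go [] = record
    { ssyt = [] , [] ; nonEmpty = [] ; sameShape = refl ; ↭-word = ↭-refl ; ↭-steps = ↭-refl }
  go (w ∶ rw ∶ʳ x) rewrite rsk-∷ʳ w x = record
    { ssyt      = Insertion-SSYT t (ssyt IH)
    ; nonEmpty  = subst (All (0 <_)) (sym (Insertion-shape t)) (addBox-nonEmpty i _ (nonEmpty IH))
    ; sameShape = begin
        shape (proj₁ (insertT x P))  ≡⟨ Insertion-shape t ⟩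
        addBox i (shape P)           ≡⟨ cong (addBox i) (sameShape IH) ⟩
        addBox i (shape Q)           ≡⟨ addAt-shape n i Q ⟨
        shape (addAt n i Q)          ∎
    ; ↭-word    = ↭-trans (Insertion-↭ t) (↭-trans (prep x (↭-word IH)) (∷↭∷ʳ x w))
    ; ↭-steps   = subst (λ m → concat (addAt n i Q) ↭ oneTo m) (sym (length-∷ʳ w x))
                    (↭-trans (addAt-↭ n i Q)
                             (↭-trans (prep n (↭-steps IH)) (↭-sym (oneTo-suc-↭ (length w)))))
    }
    where
    open RSKPair
    open ≡-Reasoning
    IH = go rw
    P = proj₁ (rsk w)
    Q = proj₂ (rsk w)
    n = suc (length w)
    i = proj₂ (insertT x P)
    t = insertT-view x P

unRSK : ℕ → Tableau → Tableau → List ℕ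
unRSK zero    P Q = []
unRSK (suc n) P Q =
  let i = rowOf (suc n) Q ; (x , P′) = uninsert i P in unRSK n P′ (removeBox i Q) ∷ʳ x

unRSK-suc : ∀ n P′ Q′ {i x P Q} → rowOf (suc n) Q′ ≡ i → uninsert i P′ ≡ (x , P) →
            removeBox i Q′ ≡ Q → unRSK (suc n) P′ Q′ ≡ unRSK n P Q ∷ʳ x
unRSK-suc n P′ Q′ refl eq refl rewrite eq = refl

suc∉oneTo : ∀ n → suc n ∉ oneTo n
suc∉oneTo n sn∈ with ∈-map⁻ suc sn∈
... | j , j∈ , sn≡sj = <⇒≱ (∈-upTo⁻ j∈) (≤-reflexive (suc-injective sn≡sj))

length-shape : ∀ {P Q : Tableau} → shape P ≡ shape Q → length P ≡ length Q
length-shape {P} {Q} eq =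
  trans (sym (length-map length P)) (trans (cong length eq) (length-map length Q))

unRSK-rsk : ∀ w → unRSK (length w) (proj₁ (rsk w)) (proj₂ (rsk w)) ≡ w
unRSK-rsk w = go (reverseView w)
  where
  go : ∀ {w} → Reverse w → unRSK (length w) (proj₁ (rsk w)) (proj₂ (rsk w)) ≡ w
  go [] = refl
  go (w ∶ rw ∶ʳ x) rewrite rsk-∷ʳ w x | length-∷ʳ w x =
    trans (unRSK-suc (length w) _ (addAt n i Q) rowOf≡ uninsert≡ removeBox≡) (cong (_∷ʳ x) (go rw))
    where
    open RSKPair
    I = rsk-pair w
    P = proj₁ (rsk w)
    Q = proj₂ (rsk w)
    n = suc (length w)
    i = proj₂ (insertT x P)
    i≤ : i ≤ length Q
    i≤ = subst (i ≤_) (length-shape (sameShape I)) (Insertion-index≤ (insertT-view x P))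
    rowOf≡ = rowOf-addAt n i Q (suc∉oneTo (length w) ∘ ∈-resp-↭ (↭-steps I)) i≤
    uninsert≡ = uninsert-insert (insertT-view x P) (proj₁ (ssyt I)) (nonEmpty I)
    removeBox≡ = removeBox-addAt n i Q (subst (All (0 <_)) (sameShape I) (nonEmpty I)) i≤

oneTo-≤ : ∀ n → All (_≤ n) (oneTo n)
oneTo-≤ n = All.tabulate λ j∈ → case ∈-map⁻ suc j∈ of λ { (j , j∈upTo , refl) → ∈-upTo⁻ j∈upTo }

IsStandard : ℕ → Tableau → Set
IsStandard n T = (concat T ↭ oneTo n) × All (Linked _<_) T × Linked (ColRel _<_) T × RowsNonEmpty T

addBox≢[] : ∀ i a → addBox i a ≢ []
addBox≢[] _       []      ()
addBox≢[] zero    (_ ∷ _) ()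
addBox≢[] (suc _) (_ ∷ _) ()

addBox-injective : ∀ i a b → All (0 <_) a → All (0 <_) b → addBox i a ≡ addBox i b → a ≡ b
addBox-injective _       []       []       _        _        _    = refl
addBox-injective zero    []       (_ ∷ []) _        (() ∷ _) refl
addBox-injective zero    (_ ∷ []) []       (() ∷ _) _        refl
addBox-injective zero    (_ ∷ _)  (_ ∷ _)  _        _        refl = refl
addBox-injective (suc i) []       (_ ∷ b)  _        _        eq   =
  contradiction (sym (∷-injectiveʳ eq)) (addBox≢[] i b)
addBox-injective (suc i) (_ ∷ a)  []       _        _        eq   =
  contradiction (∷-injectiveʳ eq) (addBox≢[] i a)
addBox-injective (suc i) (x ∷ a)  (_ ∷ b)  (_ ∷ pa) (_ ∷ pb) eq
  with refl , eq′ ← ∷-injective eq = cong (x ∷_) (addBox-injective i a b pa pb eq′)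

rsk-∷ʳ-≡ : ∀ w x {S′ T′ S T i} → rsk w ≡ (S′ , T′) → insertT x S′ ≡ (S , i) →
           addAt (suc (length w)) i T′ ≡ T → rsk (w ∷ʳ x) ≡ (S , T)
rsk-∷ʳ-≡ w x eq₁ eq₂ refl rewrite rsk-∷ʳ w x | eq₁ | eq₂ = refl

-- The entry n sits at a corner of T; un-inserting S at the same corner reduces n.
rsk-unRSK : ∀ n T S → IsStandard n T → IsSSYT S → RowsNonEmpty S → shape S ≡ shape T →
            rsk (unRSK n S T) ≡ (S , T) × length (unRSK n S T) ≡ n
rsk-unRSK zero []            []      _                    _ _ _  = refl , refl
rsk-unRSK zero []            (_ ∷ _) _                    _ _ ()
rsk-unRSK zero ((_ ∷ _) ∷ _) _       (T↭[] , _)           _ _ _  = contradiction T↭[] ¬x∷xs↭[]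
rsk-unRSK zero ([] ∷ _)      _       (_ , _ , _ , () ∷ _) _ _ _
rsk-unRSK (suc m) T S (T↭ , rowsT , colsT , nonEmptyT) ssytS nonEmptyS sameShape =
  rsk-∷ʳ-≡ w′ x (proj₁ IH) (Insertion⇒insertT (proj₁ U))
    (trans (cong (λ l → addAt (suc l) i T′) (proj₂ IH)) (MaxRemoval.readd D)) ,
  trans (length-∷ʳ w′ x) (cong suc (proj₂ IH))
  where
  open ≡-Reasoning
  k = suc m
  i = rowOf k T
  T′ = removeBox i T
  D = maxRemoval k T rowsT colsT nonEmptyT
        (All-resp-↭ (↭-sym T↭) (oneTo-≤ k))
        (∈-resp-↭ (↭-sym T↭) (∈-resp-↭ (↭-sym (oneTo-suc-↭ m)) (here refl)))
  standardT′ : IsStandard m T′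
  standardT′ = drop-∷ (↭-trans (↭-sym (MaxRemoval.↭-removed D)) (↭-trans T↭ (oneTo-suc-↭ m))) ,
               MaxRemoval.rows D , MaxRemoval.columns D , MaxRemoval.nonEmpty D
  U = uninsert-correct i S ssytS nonEmptyS (subst (IsCorner i) (sym sameShape) (MaxRemoval.corner D))
  x = proj₁ (uninsert i S)
  S′ = proj₂ (uninsert i S)
  sameShape′ : shape S′ ≡ shape T′
  sameShape′ = addBox-injective i (shape S′) (shape T′) (proj₂ (proj₂ U)) (MaxRemoval.nonEmpty D)
    (begin
      addBox i (shape S′)   ≡⟨ Insertion-shape (proj₁ U) ⟨
      shape S               ≡⟨ sameShape ⟩
      shape T               ≡⟨ cong shape (MaxRemoval.readd D) ⟨
      shape (addAt k i T′)  ≡⟨ addAt-shape k i T′ ⟩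
      addBox i (shape T′)   ∎)
  IH = rsk-unRSK m T′ S′ standardT′ (proj₁ (proj₂ U)) (proj₂ (proj₂ U)) sameShape′
  w′ = unRSK m S′ T′

-- Relabelling

-- Insertion commutes with a monotone relabelling φ provided equally labelled letters arrive in
-- increasing order; the invariant is that among equally labelled entries of the insertion tableau,
-- those in lower rows are smaller (LowerFirst).
module Relabel (φ : ℕ → ℕ) (φ-mono : ∀ {a b} → a ≤ b → φ a ≤ φ b) where

  _◁_ : ℕ → ℕ → Set
  a ◁ c = φ a ≡ φ c → a < c

  relabel : Tableau → Tableau
  relabel = map (map φ)

  LowerFirst : Tableau → Set
  LowerFirst []       = ⊤
  LowerFirst (r ∷ rs) = All (λ a → All (_◁ a) (concat rs)) r × LowerFirst rs

  ≤∧◁⇒< : ∀ {a c} → a ≤ c → a ◁ c → a < c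
  ≤∧◁⇒< a≤c a◁c with m≤n⇒m<n∨m≡n a≤c
  ... | inj₁ a<c  = a<c
  ... | inj₂ refl = a◁c refl

  RowInsertion-relabel : ∀ {x r o r′} → All (_◁ x) r → RowInsertion x r (o , r′) →
                         RowInsertion (φ x) (map φ r) (Maybe.map φ o , map φ r′)
  RowInsertion-relabel _         append     = append
  RowInsertion-relabel (y◁x ∷ _) (bump x<y) with m≤n⇒m<n∨m≡n (φ-mono (<⇒≤ x<y))
  ... | inj₁ φx<φy = bump φx<φy
  ... | inj₂ φx≡φy = contradiction (y◁x (sym φx≡φy)) (<⇒≯ x<y)
  RowInsertion-relabel (_ ∷ ◁x) (skip y≤x ins) = skip (φ-mono y≤x) (RowInsertion-relabel ◁x ins)

  Insertion-relabel : ∀ {x P P′ i} → Insertion x P (P′ , i) → All (_◁ x) (concat P) →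
                      LowerFirst P → Insertion (φ x) (relabel P) (relabel P′ , i)
  Insertion-relabel newRow           _  _ = newRow
  Insertion-relabel (settle {r} ins) ◁x _ = settle (RowInsertion-relabel (++⁻ˡ r ◁x) ins)
  Insertion-relabel (bumpDown {r} ins t) ◁x (lower , lowerFirst) =
    bumpDown (RowInsertion-relabel (++⁻ˡ r ◁x) ins)
             (Insertion-relabel t (All.lookup lower (bumped∈row ins)) lowerFirst)

  RowInsertion-strict : ∀ {x r o r′} → RowInsertion x r (o , r′) → Linked _<_ r → All (_◁ x) r →
                        Linked _<_ r′
  RowInsertion-strict append                  _              _ = [-]
  RowInsertion-strict (bump {ys = []} _)      _              _ = [-]
  RowInsertion-strict (bump {ys = _ ∷ _} x<y) (y<c ∷ strict) _ = <-trans x<y y<c ∷ strict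
  RowInsertion-strict (skip y≤x ins)          strict (y◁x ∷ ◁x) =
    head<x ins (≤∧◁⇒< y≤x y◁x) (head′ strict) ∷′ RowInsertion-strict ins (Linked.tail strict) ◁x
    where
    head<x : ∀ {x r o r′ z} → RowInsertion x r (o , r′) → z < x →
             Connected _<_ (just z) (head r) → Connected _<_ (just z) (head r′)
    head<x append     z<x _ = just z<x
    head<x (bump _)   z<x _ = just z<x
    head<x (skip _ _) _   c = c

  bumped◁row : ∀ {x r z r′} → RowInsertion x r (just z , r′) → Linked _<_ r → All (_◁ x) r →
               All (z ◁_) r′
  bumped◁row (bump x<z) strict (z◁x ∷ _) =
    (λ φz≡φx → contradiction (z◁x φz≡φx) (<⇒≯ x<z)) ∷
    All.map (λ z<c _ → z<c) (Linked-headAll <-trans strict)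
  bumped◁row (skip c≤x ins) strict (_ ∷ ◁x) =
    (λ φz≡φc → contradiction (All.lookup ◁x (bumped∈row ins) (φz≡φx φz≡φc)) (<⇒≯ x<z)) ∷
    bumped◁row ins (Linked.tail strict) ◁x
    where
    x<z = bumped>inserted ins
    φz≡φx = λ φz≡φc → ≤-antisym (≤-trans (≤-reflexive φz≡φc) (φ-mono c≤x)) (φ-mono (<⇒≤ x<z))

  Insertion-lowerFirst : ∀ {x P P′ i} → Insertion x P (P′ , i) → LowerFirst P →
                         All (Linked _<_) P → All (_◁ x) (concat P) → LowerFirst P′
  Insertion-lowerFirst newRow _ _ _ = ([] ∷ []) , tt
  Insertion-lowerFirst (settle {r} ins) (lower , lowerFirst) _ ◁x
    rewrite RowInsertion-append ins = ∷ʳ⁺ lower (++⁻ʳ r ◁x) , lowerFirst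
  Insertion-lowerFirst (bumpDown {r} {r′} {rs} ins t) (lower , lowerFirst) (strict ∷ stricts) ◁x =
    All.zipWith (λ (y◁a , ◁a) → All-resp-↭ (↭-sym (Insertion-↭ t)) (y◁a ∷ ◁a))
                (bumped◁row ins strict (++⁻ˡ r ◁x) , lower′) ,
    Insertion-lowerFirst t lowerFirst stricts (All.lookup lower (bumped∈row ins))
    where
    lower′ : All (λ a → All (_◁ a) (concat rs)) r′
    lower′ = All.tail (All-resp-↭ (↭-sym (RowInsertion-bump-↭ ins)) (++⁻ʳ r ◁x ∷ lower))

  Insertion-strict : ∀ {x P P′ i} → Insertion x P (P′ , i) → All (Linked _<_) P →
                     All (_◁ x) (concat P) → LowerFirst P → All (Linked _<_) P′
  Insertion-strict newRow _ _ _ = [-] ∷ []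
  Insertion-strict (settle {r} ins) (strict ∷ stricts) ◁x _ =
    RowInsertion-strict ins strict (++⁻ˡ r ◁x) ∷ stricts
  Insertion-strict (bumpDown {r} ins t) (strict ∷ stricts) ◁x (lower , lowerFirst) =
    RowInsertion-strict ins strict (++⁻ˡ r ◁x) ∷
    Insertion-strict t stricts (All.lookup lower (bumped∈row ins)) lowerFirst

  rskGo-relabel : ∀ s P Q σ → LowerFirst P → All (Linked _<_) P →
                  All (λ a → All (a ◁_) σ) (concat P) → AllPairs _◁_ σ →
                  proj₂ (rskGo s P Q σ) ≡ proj₂ (rskGo s (relabel P) Q (map φ σ))
  rskGo-relabel s P Q []      _          _      _  _                = refl
  rskGo-relabel s P Q (c ∷ σ) lowerFirst strict ◁σ (c◁σ ∷ σ-sorted)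
    rewrite Insertion⇒insertT (Insertion-relabel (insertT-view c P) (All.map All.head ◁σ) lowerFirst) =
    rskGo-relabel (suc s) (proj₁ (insertT c P)) (addAt (suc s) (proj₂ (insertT c P)) Q) σ
      (Insertion-lowerFirst t lowerFirst strict ◁c) (Insertion-strict t strict ◁c lowerFirst)
      (All-resp-↭ (↭-sym (Insertion-↭ t)) (c◁σ ∷ All.map All.tail ◁σ)) σ-sorted
    where
    t = insertT-view c P
    ◁c = All.map All.head ◁σ

  recordingTableau-relabel : ∀ σ → AllPairs _◁_ σ →
                             recordingTableau σ ≡ recordingTableau (map φ σ)
  recordingTableau-relabel σ = rskGo-relabel 0 [] [] σ tt [] []

-- The deck of a shuffle

count-≡ : ∀ {a} x l → a ≡ x → count a (x ∷ l) ≡ suc (count a l)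
count-≡ {a} x l a≡x with a ≟ x
... | yes _   = refl
... | no  a≢x = contradiction a≡x a≢x

count-≢ : ∀ {a} x l → a ≢ x → count a (x ∷ l) ≡ count a l
count-≢ {a} x l a≢x with a ≟ x
... | yes a≡x = contradiction a≡x a≢x
... | no  _   = refl

count-∷-≤ : ∀ a x l → count a l ≤ count a (x ∷ l)
count-∷-≤ a x l with a ≟ x
... | yes _ = n≤1+n _
... | no  _ = ≤-refl

count-move : ∀ a x u r → count a (x ∷ u) + count a r ≡ count a u + count a (x ∷ r)
count-move a x u r with a ≟ x
... | yes _ = sym (+-suc (count a u) (count a r))
... | no  _ = refl

count≡length-filter : ∀ a l → count a l ≡ length (filter (a ≟_) l)
count≡length-filter a []       = refl
count≡length-filter a (y ∷ ys) with a ≟ y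
... | yes a≡y =
  trans (cong suc (count≡length-filter a ys)) (cong length (sym (filter-accept (a ≟_) a≡y)))
... | no  a≢y =
  trans (count≡length-filter a ys) (cong length (sym (filter-reject (a ≟_) a≢y)))

content-↭ : ∀ k {l l′} → l ↭ l′ → content k l ≡ content k l′
content-↭ k {l} {l′} l↭l′ = map-cong (λ a → begin
  count a l                  ≡⟨ count≡length-filter a l ⟩
  length (filter (a ≟_) l)   ≡⟨ ↭-length (filter-↭ (a ≟_) l↭l′) ⟩
  length (filter (a ≟_) l′)  ≡⟨ count≡length-filter a l′ ⟨
  count a l′                 ∎) (oneTo k)
  where open ≡-Reasoning

∈-oneTo⁺ : ∀ {j k} → j < k → suc j ∈ oneTo k
∈-oneTo⁺ j<k = ∈-map⁺ suc (∈-upTo⁺ j<k)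

∈-oneTo⁻ : ∀ {i k} → i ∈ oneTo k → ∃ λ j → i ≡ suc j × j < k
∈-oneTo⁻ i∈ with ∈-map⁻ suc i∈
... | j , j∈ , i≡sj = j , i≡sj , ∈-upTo⁻ j∈

-- μ_i, with piles numbered from 1 as in offset.
pileSize : List ℕ → ℕ → ℕ
pileSize []       _             = 0
pileSize (_ ∷ _)  zero          = 0
pileSize (m ∷ _)  (suc zero)    = m
pileSize (_ ∷ ms) (suc (suc i)) = pileSize ms (suc i)

pileSize-map-oneTo : ∀ k (f : ℕ → ℕ) j → j < k → pileSize (map f (oneTo k)) (suc j) ≡ f (suc j)
pileSize-map-oneTo (suc k) f zero    _         = refl
pileSize-map-oneTo (suc k) f (suc j) (s≤s j<k) = begin
  pileSize (map f (map suc (applyUpTo suc k))) (suc j)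
    ≡⟨ cong (λ l → pileSize (map f (map suc l)) (suc j)) (map-applyUpTo id suc k) ⟨
  pileSize (map f (map suc (oneTo k))) (suc j)
    ≡⟨ cong (λ l → pileSize l (suc j)) (map-∘ (oneTo k)) ⟨
  pileSize (map (f ∘ suc) (oneTo k)) (suc j)
    ≡⟨ pileSize-map-oneTo k (f ∘ suc) j j<k ⟩
  f (suc (suc j)) ∎
  where open ≡-Reasoning

-- The pile containing card c, with cards and piles numbered from 1.
pile : List ℕ → ℕ → ℕ
pile []       c = 1
pile (m ∷ ms) c with c ≤? m
... | yes _ = 1
... | no  _ = suc (pile ms (c ∸ m))

pile-mono : ∀ μ {c c′} → c ≤ c′ → pile μ c ≤ pile μ c′
pile-mono []       _ = ≤-refl
pile-mono (m ∷ ms) {c} {c′} c≤c′ with c ≤? m | c′ ≤? m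
... | yes _   | yes _    = ≤-refl
... | yes _   | no  _    = s≤s z≤n
... | no  c≰m | yes c′≤m = contradiction (≤-trans c≤c′ c′≤m) c≰m
... | no  _   | no  _    = s≤s (pile-mono ms (∸-monoˡ-≤ m c≤c′))

pile-beyond : ∀ m ms {d} → 0 < d → pile (m ∷ ms) (m + d) ≡ suc (pile ms d)
pile-beyond m ms {d} 0<d with m + d ≤? m
... | yes ≤m = contradiction ≤m (<⇒≱ (m<m+n m 0<d))
... | no  _  = cong (λ n → suc (pile ms n)) (m+n∸m≡n m d)

pile-offset : ∀ μ j c → c < pileSize μ (suc j) → pile μ (offset μ (suc j) + c + 1) ≡ suc j
pile-offset (m ∷ ms) zero c c<m with c + 1 ≤? m
... | yes _   = refl
... | no  c≮m = contradiction (subst (_≤ m) (+-comm 1 c) c<m) c≮m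
pile-offset (m ∷ ms) (suc j) c c< = begin
  pile (m ∷ ms) (m + o + c + 1)    ≡⟨ cong (λ n → pile (m ∷ ms) (n + 1)) (+-assoc m o c) ⟩
  pile (m ∷ ms) (m + (o + c) + 1)  ≡⟨ cong (pile (m ∷ ms)) (+-assoc m (o + c) 1) ⟩
  pile (m ∷ ms) (m + (o + c + 1))  ≡⟨ pile-beyond m ms (m≤n+m 1 (o + c)) ⟩
  suc (pile ms (o + c + 1))        ≡⟨ cong suc (pile-offset ms j c c<) ⟩
  suc (suc j)                      ∎
  where
  open ≡-Reasoning
  o = offset ms (suc j)

module Deck (μ : List ℕ) where
  open Relabel (pile μ) (pile-mono μ)

  k : ℕ
  k = length μ

  card : List ℕ → ℕ → ℕ
  card used i = offset μ i + count i used + 1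

  Balanced : List ℕ → List ℕ → Set
  Balanced used rest =
    ∀ j → j < k → count (suc j) used + count (suc j) rest ≡ pileSize μ (suc j)

  Balanced-step : ∀ used i rest → Balanced used (i ∷ rest) → Balanced (i ∷ used) rest
  Balanced-step used i rest balanced j j<k =
    trans (count-move (suc j) i used rest) (balanced j j<k)

  pile-card : ∀ used i rest → Balanced used (i ∷ rest) → i ∈ oneTo k → pile μ (card used i) ≡ i
  pile-card used i rest balanced i∈ with ∈-oneTo⁻ i∈
  ... | j , refl , j<k = pile-offset μ j (count (suc j) used) (begin-strict
    count (suc j) used
      <⟨ m<m+n _ (subst (0 <_) (sym (count-≡ (suc j) rest refl)) (s≤s z≤n)) ⟩
    count (suc j) used + count (suc j) (suc j ∷ rest)
      ≡⟨ balanced j j<k ⟩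
    pileSize μ (suc j) ∎)
    where open ≤-Reasoning

  deck-pile : ∀ used rest → Balanced used rest → All (_∈ oneTo k) rest →
              map (pile μ) (deckGo μ used rest) ≡ rest
  deck-pile used []         _        _            = refl
  deck-pile used (i ∷ rest) balanced (i∈ ∷ rest∈) =
    cong₂ _∷_ (pile-card used i rest balanced i∈)
              (deck-pile (i ∷ used) rest (Balanced-step used i rest balanced) rest∈)

  deck-lowerBound : ∀ used rest → Balanced used rest → All (_∈ oneTo k) rest →
                    All (λ c → card used (pile μ c) ≤ c) (deckGo μ used rest)
  deck-lowerBound used []         _        _            = []
  deck-lowerBound used (i ∷ rest) balanced (i∈ ∷ rest∈) =
    subst (λ p → card used p ≤ card used i) (sym (pile-card used i rest balanced i∈)) ≤-refl ∷
    All.map (λ {c} → ≤-trans (card-mono (pile μ c)))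
            (deck-lowerBound (i ∷ used) rest (Balanced-step used i rest balanced) rest∈)
    where
    card-mono : ∀ p → card used p ≤ card (i ∷ used) p
    card-mono p = +-monoˡ-≤ 1 (+-monoʳ-≤ (offset μ p) (count-∷-≤ p i used))

  deck-sorted : ∀ used rest → Balanced used rest → All (_∈ oneTo k) rest →
                AllPairs _◁_ (deckGo μ used rest)
  deck-sorted used []         _        _            = []
  deck-sorted used (i ∷ rest) balanced (i∈ ∷ rest∈) =
    All.map next (deck-lowerBound (i ∷ used) rest balanced′ rest∈) ∷
    deck-sorted (i ∷ used) rest balanced′ rest∈
    where
    balanced′ = Balanced-step used i rest balanced
    next : ∀ {c} → card (i ∷ used) (pile μ c) ≤ c → card used i ◁ c
    next {c} bound same rewrite pile-card used i rest balanced i∈ | sym same | count-≡ i used refl =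
      subst (_≤ c) (cong (_+ 1) (+-suc (offset μ i) (count i used))) bound

  recordingTableau-deck : ∀ w → All (_∈ oneTo k) w → content k w ≡ μ →
                          recordingTableau (deck μ w) ≡ recordingTableau w
  recordingTableau-deck w w∈ content≡μ =
    trans (recordingTableau-relabel (deck μ w) (deck-sorted [] w balanced w∈))
          (cong recordingTableau (deck-pile [] w balanced w∈))
    where
    balanced : Balanced [] w
    balanced j j<k = trans (sym (pileSize-map-oneTo k (λ i → count i w) j j<k))
                           (cong (λ ν → pileSize ν (suc j)) content≡μ)

-- Counting

length-bijection : ∀ {A B : Set} {xs : List A} {ys : List B} (f : A → B) (g : B → A) →
                   Unique xs → Unique ys →
                   (∀ {x} → x ∈ xs → f x ∈ ys × g (f x) ≡ x) →
                   (∀ {y} → y ∈ ys → g y ∈ xs × f (g y) ≡ y) →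
                   length xs ≡ length ys
length-bijection {xs = xs} {ys} f g xs! ys! to from = begin
  length xs          ≡⟨ length-map f xs ⟨
  length (map f xs)  ≡⟨ ↭-length (∼bag⇒↭ (unique∧set⇒bag fxs! ys! (mk⇔ forth back))) ⟩
  length ys          ∎
  where
  open ≡-Reasoning
  gfxs≡xs : map g (map f xs) ≡ xs
  gfxs≡xs = trans (sym (map-∘ xs)) (map-id-local (All.tabulate (proj₂ ∘ to)))
  fxs! : Unique (map f xs)
  fxs! = Unique.map⁻ (subst Unique (sym gfxs≡xs) xs!)
  forth : ∀ {z} → z ∈ map f xs → z ∈ ys
  forth z∈ with ∈-map⁻ f z∈
  ... | _ , x∈ , refl = proj₁ (to x∈)
  back : ∀ {z} → z ∈ ys → z ∈ map f xs
  back z∈ = subst (_∈ map f xs) (proj₂ (from z∈)) (∈-map⁺ f (proj₁ (from z∈)))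

length-cartesianProduct : ∀ {A B : Set} (xs : List A) (ys : List B) →
                          length (cartesianProduct xs ys) ≡ length xs * length ys
length-cartesianProduct []       ys = refl
length-cartesianProduct (x ∷ xs) ys =
  trans (length-++ (map (x ,_) ys)) (cong₂ _+_ (length-map (x ,_) ys) (length-cartesianProduct xs ys))

concatMap≡cartesianProduct∷ : ∀ {A : Set} (as : List A) (bs : List (List A)) →
                              concatMap (λ a → map (a ∷_) bs) as ≡ cartesianProductWith _∷_ as bs
concatMap≡cartesianProduct∷ []       bs = refl
concatMap≡cartesianProduct∷ (a ∷ as) bs =
  cong (map (a ∷_) bs ++_) (concatMap≡cartesianProduct∷ as bs)

Unique-cartesianProduct∷ : ∀ {A : Set} {as : List A} {bs : List (List A)} →
                           Unique as → Unique bs → Unique (concatMap (λ a → map (a ∷_) bs) as)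
Unique-cartesianProduct∷ {as = as} {bs} as! bs! =
  subst Unique (sym (concatMap≡cartesianProduct∷ as bs))
        (Unique.cartesianProductWith⁺ _∷_ ∷-injective as! bs!)

∈-cartesianProduct∷⁺ : ∀ {A : Set} {as : List A} {bs : List (List A)} {a b} →
                       a ∈ as → b ∈ bs → a ∷ b ∈ concatMap (λ a → map (a ∷_) bs) as
∈-cartesianProduct∷⁺ {as = as} {bs} a∈ b∈ =
  subst (_ ∈_) (sym (concatMap≡cartesianProduct∷ as bs)) (∈-cartesianProductWith⁺ _∷_ a∈ b∈)

∈-cartesianProduct∷⁻ : ∀ {A : Set} (as : List A) (bs : List (List A)) {v} →
                       v ∈ concatMap (λ a → map (a ∷_) bs) as →
                       ∃ λ (a : A) → ∃ λ (b : List A) → a ∈ as × b ∈ bs × v ≡ a ∷ b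
∈-cartesianProduct∷⁻ as bs v∈ =
  ∈-cartesianProductWith⁻ _∷_ as bs (subst (_ ∈_) (concatMap≡cartesianProduct∷ as bs) v∈)

Unique-oneTo : ∀ k → Unique (oneTo k)
Unique-oneTo k = Unique.map⁺ suc-injective (Unique.upTo⁺ k)

Unique-words : ∀ m k → Unique (words m k)
Unique-words zero    k = [] ∷ []
Unique-words (suc m) k = Unique-cartesianProduct∷ (Unique-oneTo k) (Unique-words m k)

∈-words⁺ : ∀ m k w → length w ≡ m → All (_∈ oneTo k) w → w ∈ words m k
∈-words⁺ zero    k []      _   _         = here refl
∈-words⁺ (suc m) k (a ∷ w) len (a∈ ∷ w∈) =
  ∈-cartesianProduct∷⁺ a∈ (∈-words⁺ m k w (suc-injective len) w∈)

∈-words⁻ : ∀ m k w → w ∈ words m k → length w ≡ m × All (_∈ oneTo k) w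
∈-words⁻ zero    k w (here refl) = refl , []
∈-words⁻ (suc m) k w w∈ with ∈-cartesianProduct∷⁻ (oneTo k) (words m k) w∈
... | a , v , a∈ , v∈ , refl = Product.map (cong suc) (a∈ ∷_) (∈-words⁻ m k v v∈)

Unique-fillings : ∀ sh k → Unique (fillings sh k)
Unique-fillings []       k = [] ∷ []
Unique-fillings (r ∷ sh) k = Unique-cartesianProduct∷ (Unique-words r k) (Unique-fillings sh k)

∈-fillings⁺ : ∀ sh k S → shape S ≡ sh → All (All (_∈ oneTo k)) S → S ∈ fillings sh k
∈-fillings⁺ []       k []      _      _         = here refl
∈-fillings⁺ (r ∷ sh) k (w ∷ S) shape≡ (w∈ ∷ S∈) =
  ∈-cartesianProduct∷⁺ (∈-words⁺ r k w (∷-injectiveˡ shape≡) w∈)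
                       (∈-fillings⁺ sh k S (∷-injectiveʳ shape≡) S∈)

∈-fillings⁻ : ∀ sh k S → S ∈ fillings sh k → shape S ≡ sh × All (All (_∈ oneTo k)) S
∈-fillings⁻ []       k S (here refl) = refl , []
∈-fillings⁻ (r ∷ sh) k S S∈ with ∈-cartesianProduct∷⁻ (words r k) (fillings sh k) S∈
... | w , S′ , w∈ , S′∈ , refl =
  Product.zip (cong₂ _∷_) _∷_ (∈-words⁻ r k w w∈) (∈-fillings⁻ sh k S′ S′∈)

length-filter-map : ∀ {A B : Set} {P : B → Set} (P? : ∀ b → Dec (P b)) (f : A → B) xs →
                    length (filter P? (map f xs)) ≡ length (filter (P? ∘ f) xs)
length-filter-map P? f []       = refl
length-filter-map P? f (x ∷ xs) with does (P? (f x))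
... | true  = cong suc (length-filter-map P? f xs)
... | false = length-filter-map P? f xs

length-filter-++ : ∀ {A : Set} {P : A → Set} (P? : ∀ a → Dec (P a)) xs ys →
                   length (filter P? (xs ++ ys)) ≡ length (filter P? xs) + length (filter P? ys)
length-filter-++ P? xs ys = trans (cong length (filter-++ P? xs ys)) (length-++ (filter P? xs))

boolWords : ℕ → List (List Bool)
boolWords zero    = [ [] ]
boolWords (suc n) = concatMap (λ b → map (b ∷_) (boolWords n)) (true ∷ false ∷ [])

trues : List Bool → ℕ
trues []          = 0
trues (true ∷ b)  = suc (trues b)
trues (false ∷ b) = trues b

falses : List Bool → ℕ
falses []          = 0
falses (true ∷ b)  = falses b
falses (false ∷ b) = suc (falses b)

trues+falses : ∀ b → trues b + falses b ≡ length b
trues+falses []          = refl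
trues+falses (true ∷ b)  = cong suc (trues+falses b)
trues+falses (false ∷ b) = trans (+-suc (trues b) (falses b)) (cong suc (trues+falses b))

Unique-boolWords : ∀ n → Unique (boolWords n)
Unique-boolWords zero    = [] ∷ []
Unique-boolWords (suc n) =
  Unique-cartesianProduct∷ {as = true ∷ false ∷ []} (((λ ()) ∷ []) ∷ [] ∷ []) (Unique-boolWords n)

∈-boolWords⁺ : ∀ n b → length b ≡ n → b ∈ boolWords n
∈-boolWords⁺ zero    []          _   = here refl
∈-boolWords⁺ (suc n) (true ∷ b)  len =
  ∈-cartesianProduct∷⁺ {as = true ∷ false ∷ []} (here refl) (∈-boolWords⁺ n b (suc-injective len))
∈-boolWords⁺ (suc n) (false ∷ b) len =
  ∈-cartesianProduct∷⁺ {as = true ∷ false ∷ []} (there (here refl))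
                       (∈-boolWords⁺ n b (suc-injective len))

∈-boolWords⁻ : ∀ n b → b ∈ boolWords n → length b ≡ n
∈-boolWords⁻ zero    b (here refl) = refl
∈-boolWords⁻ (suc n) b b∈ with ∈-cartesianProduct∷⁻ (true ∷ false ∷ []) (boolWords n) b∈
... | _ , b′ , _ , b′∈ , refl = cong suc (∈-boolWords⁻ n b′ b′∈)

length-boolWords-trues : ∀ n m → length (filter (λ b → trues b ≟ m) (boolWords n)) ≡ n C m
length-boolWords-trues zero    zero    = refl
length-boolWords-trues zero    (suc m) = refl
length-boolWords-trues (suc n) m       = begin
  length (filter P? (map (true ∷_) bs ++ map (false ∷_) bs ++ []))
    ≡⟨ length-filter-++ P? (map (true ∷_) bs) _ ⟩
  length (filter P? (map (true ∷_) bs)) + length (filter P? (map (false ∷_) bs ++ []))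
    ≡⟨ cong (λ l → length (filter P? (map (true ∷_) bs)) + length (filter P? l))
            (++-identityʳ (map (false ∷_) bs)) ⟩
  length (filter P? (map (true ∷_) bs)) + length (filter P? (map (false ∷_) bs))
    ≡⟨ cong₂ _+_ (length-filter-map P? (true ∷_) bs) (length-filter-map P? (false ∷_) bs) ⟩
  length (filter (λ b → suc (trues b) ≟ m) bs) + length (filter P? bs)
    ≡⟨ cong (length (filter (λ b → suc (trues b) ≟ m) bs) +_) (length-boolWords-trues n m) ⟩
  length (filter (λ b → suc (trues b) ≟ m) bs) + n C m
    ≡⟨ pascal m ⟩
  suc n C m ∎
  where
  open ≡-Reasoning
  bs = boolWords n
  P? = λ b → trues b ≟ m
  pascal : ∀ m → length (filter (λ b → suc (trues b) ≟ m) bs) + n C m ≡ suc n C m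
  pascal zero    =
    cong (λ l → length l + 1) (filter-none (λ b → suc (trues b) ≟ 0) {xs = bs} (All.tabulate λ _ ()))
  pascal (suc m) = begin
    length (filter (λ b → suc (trues b) ≟ suc m) bs) + n C suc m
      ≡⟨ cong (λ l → length l + n C suc m) (filter-≐ _ _ (suc-injective , cong suc) bs) ⟩
    length (filter (λ b → trues b ≟ m) bs) + n C suc m
      ≡⟨ cong (_+ n C suc m) (length-boolWords-trues n m) ⟩
    n C m + n C suc m
      ≡⟨ nCk+nC[k+1]≡[n+1]C[k+1] n m ⟩
    suc n C suc m ∎

-- The boolean word marks the letters 1; the other letters are lowered by one.
split : List ℕ → List Bool × List ℕ
split []             = [] , []
split (suc zero ∷ w) = map₁ (true ∷_) (split w)
split (x ∷ w)        = Product.map (false ∷_) (pred x ∷_) (split w)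

merge : List Bool → List ℕ → List ℕ
merge []          _       = []
merge (true ∷ b)  v       = 1 ∷ merge b v
merge (false ∷ b) []      = []
merge (false ∷ b) (x ∷ v) = suc x ∷ merge b v

merge-split : ∀ w → All (0 <_) w → uncurry merge (split w) ≡ w
merge-split []                _        = refl
merge-split (suc zero ∷ w)    (_ ∷ ps) = cong (1 ∷_) (merge-split w ps)
merge-split (suc (suc x) ∷ w) (_ ∷ ps) = cong (suc (suc x) ∷_) (merge-split w ps)

split-merge : ∀ b v → All (0 <_) v → length v ≡ falses b → split (merge b v) ≡ (b , v)
split-merge []          []          _        _   = refl
split-merge (true ∷ b)  v           ps       len rewrite split-merge b v ps len = refl
split-merge (false ∷ b) (suc x ∷ v) (_ ∷ ps) len
  rewrite split-merge b v ps (suc-injective len) = refl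

length-split₁ : ∀ w → length (proj₁ (split w)) ≡ length w
length-split₁ []                = refl
length-split₁ (zero ∷ w)        = cong suc (length-split₁ w)
length-split₁ (suc zero ∷ w)    = cong suc (length-split₁ w)
length-split₁ (suc (suc _) ∷ w) = cong suc (length-split₁ w)

length-split₂ : ∀ w → length (proj₂ (split w)) ≡ falses (proj₁ (split w))
length-split₂ []                = refl
length-split₂ (zero ∷ w)        = cong suc (length-split₂ w)
length-split₂ (suc zero ∷ w)    = length-split₂ w
length-split₂ (suc (suc _) ∷ w) = cong suc (length-split₂ w)

trues-split : ∀ w → trues (proj₁ (split w)) ≡ count 1 w
trues-split []                = refl
trues-split (zero ∷ w)        = trues-split w
trues-split (suc zero ∷ w)    = cong suc (trues-split w)
trues-split (suc (suc _) ∷ w) = trues-split w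

count-split : ∀ j w → count (suc (suc j)) w ≡ count (suc j) (proj₂ (split w))
count-split j []                = refl
count-split j (zero ∷ w)        = count-split j w
count-split j (suc zero ∷ w)    = count-split j w
count-split j (suc (suc x) ∷ w) with j ≟ x
... | yes refl =
  trans (count-≡ _ w refl) (trans (cong suc (count-split j w)) (sym (count-≡ _ (proj₂ (split w)) refl)))
... | no  j≢x  =
  trans (count-≢ _ w (j≢x ∘ suc-injective ∘ suc-injective))
        (trans (count-split j w) (sym (count-≢ _ (proj₂ (split w)) (j≢x ∘ suc-injective))))

content-split : ∀ k w → content (suc k) w ≡ count 1 w ∷ content k (proj₂ (split w))
content-split k w = cong (count 1 w ∷_) (begin
  map (λ i → count i w) (map suc (applyUpTo suc k))
    ≡⟨ cong (λ l → map (λ i → count i w) (map suc l)) (map-applyUpTo id suc k) ⟨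
  map (λ i → count i w) (map suc (oneTo k))
    ≡⟨ map-∘ (oneTo k) ⟨
  map (λ i → count (suc i) w) (oneTo k)
    ≡⟨ map-∘ (upTo k) ⟨
  map (λ j → count (suc (suc j)) w) (upTo k)
    ≡⟨ map-cong (λ j → count-split j w) (upTo k) ⟩
  map (λ j → count (suc j) (proj₂ (split w))) (upTo k)
    ≡⟨ map-∘ (upTo k) ⟩
  content k (proj₂ (split w)) ∎)
  where open ≡-Reasoning

letters-positive : ∀ {k w} → All (_∈ oneTo k) w → All (0 <_) w
letters-positive = All.map λ i∈ → case ∈-oneTo⁻ i∈ of λ { (_ , refl , _) → s≤s z≤n }

letters-split : ∀ k w → All (_∈ oneTo (suc k)) w → All (_∈ oneTo k) (proj₂ (split w))
letters-split k []                _         = []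
letters-split k (zero ∷ w)        (0∈ ∷ _)  with () ← ∈-oneTo⁻ 0∈
letters-split k (suc zero ∷ w)    (_ ∷ w∈)  = letters-split k w w∈
letters-split k (suc (suc x) ∷ w) (x∈ ∷ w∈) with ∈-oneTo⁻ x∈
... | _ , refl , s≤s x<k = ∈-oneTo⁺ x<k ∷ letters-split k w w∈

letters-merge : ∀ k b v → All (_∈ oneTo k) v → All (_∈ oneTo (suc k)) (merge b v)
letters-merge k []          v       _         = []
letters-merge k (true ∷ b)  v       v∈        = ∈-oneTo⁺ (s≤s z≤n) ∷ letters-merge k b v v∈
letters-merge k (false ∷ b) []      _         = []
letters-merge k (false ∷ b) (x ∷ v) (x∈ ∷ v∈) with ∈-oneTo⁻ x∈
... | _ , refl , j<k = ∈-oneTo⁺ (s≤s j<k) ∷ letters-merge k b v v∈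

IsInterleaving : List ℕ → List ℕ → Set
IsInterleaving μ w = length w ≡ sum μ × All (_∈ oneTo (length μ)) w × content (length μ) w ≡ μ

∈-interleavings⁺ : ∀ μ w → IsInterleaving μ w → w ∈ interleavings μ
∈-interleavings⁺ μ w (len , w∈ , content≡) =
  ∈-filter⁺ (λ w → ≡-dec _≟_ (content (length μ) w) μ)
            (∈-words⁺ (sum μ) (length μ) w len w∈) content≡

∈-interleavings⁻ : ∀ μ w → w ∈ interleavings μ → IsInterleaving μ w
∈-interleavings⁻ μ w w∈ with ∈-filter⁻ (λ w → ≡-dec _≟_ (content (length μ) w) μ) w∈
... | w∈words , content≡ = Product.map₂ (_, content≡) (∈-words⁻ (sum μ) (length μ) w w∈words)

module _ (m : ℕ) (ms : List ℕ) where
  private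
    k = length ms
    N = m + sum ms

  MarksOnes : List Bool → Set
  MarksOnes b = length b ≡ N × trues b ≡ m

  split-interleaving : ∀ w → IsInterleaving (m ∷ ms) w →
                       MarksOnes (proj₁ (split w)) × IsInterleaving ms (proj₂ (split w))
  split-interleaving w (len , w∈ , content≡) =
    (trans (length-split₁ w) len , trues≡) , v-length , letters-split k w w∈ , proj₂ heads≡
    where
    open ≡-Reasoning
    heads≡ = ∷-injective (trans (sym (content-split k w)) content≡)
    trues≡ : trues (proj₁ (split w)) ≡ m
    trues≡ = trans (trues-split w) (proj₁ heads≡)
    v-length : length (proj₂ (split w)) ≡ sum ms
    v-length = +-cancelˡ-≡ m _ _ (begin
      m + length (proj₂ (split w))                        ≡⟨ cong₂ _+_ (sym trues≡) (length-split₂ w) ⟩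
      trues (proj₁ (split w)) + falses (proj₁ (split w))  ≡⟨ trues+falses (proj₁ (split w)) ⟩
      length (proj₁ (split w))                            ≡⟨ length-split₁ w ⟩
      length w                                            ≡⟨ len ⟩
      N                                                   ∎)

  merge-interleaving : ∀ b v → MarksOnes b → IsInterleaving ms v →
                       IsInterleaving (m ∷ ms) (merge b v) × split (merge b v) ≡ (b , v)
  merge-interleaving b v (b-length , trues≡) (len , v∈ , content≡) =
    (w-length , letters-merge k b v v∈ , w-content) , split∘merge
    where
    open ≡-Reasoning
    w = merge b v
    falses≡ : falses b ≡ sum ms
    falses≡ = +-cancelˡ-≡ m _ _ (begin
      m + falses b        ≡⟨ cong (_+ falses b) trues≡ ⟨
      trues b + falses b  ≡⟨ trues+falses b ⟩
      length b            ≡⟨ b-length ⟩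
      N                   ∎)
    split∘merge : split w ≡ (b , v)
    split∘merge = split-merge b v (letters-positive v∈) (trans len (sym falses≡))
    w-length : length w ≡ N
    w-length = begin
      length w                  ≡⟨ length-split₁ w ⟨
      length (proj₁ (split w))  ≡⟨ cong (length ∘ proj₁) split∘merge ⟩
      length b                  ≡⟨ b-length ⟩
      N                         ∎
    w-content : content (suc k) w ≡ m ∷ ms
    w-content = begin
      content (suc k) w
        ≡⟨ content-split k w ⟩
      count 1 w ∷ content k (proj₂ (split w))
        ≡⟨ cong₂ _∷_ (sym (trues-split w)) (cong (content k ∘ proj₂) split∘merge) ⟩
      trues (proj₁ (split w)) ∷ content k v
        ≡⟨ cong₂ _∷_ (trans (cong (trues ∘ proj₁) split∘merge) trues≡) content≡ ⟩
      m ∷ ms ∎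

length-interleavings : ∀ μ → length (interleavings μ) ≡ multinomial μ
length-interleavings []       = refl
length-interleavings (m ∷ ms) = begin
  length (interleavings (m ∷ ms))
    ≡⟨ length-bijection split (uncurry merge) (Unique.filter⁺ _ (Unique-words N (suc k)))
         (Unique.cartesianProduct⁺ (Unique.filter⁺ _ (Unique-boolWords N))
                                   (Unique.filter⁺ _ (Unique-words (sum ms) k)))
         forth back ⟩
  length (cartesianProduct markings (interleavings ms))
    ≡⟨ length-cartesianProduct markings (interleavings ms) ⟩
  length markings * length (interleavings ms)
    ≡⟨ cong₂ _*_ (length-boolWords-trues N m) (length-interleavings ms) ⟩
  (N C m) * multinomial ms ∎
  where
  open ≡-Reasoning
  k = length ms
  N = m + sum ms
  markings = filter (λ b → trues b ≟ m) (boolWords N)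
  ∈-markings⁺ : ∀ b → MarksOnes m ms b → b ∈ markings
  ∈-markings⁺ b (len , trues≡) = ∈-filter⁺ (λ b → trues b ≟ m) (∈-boolWords⁺ N b len) trues≡
  ∈-markings⁻ : ∀ b → b ∈ markings → MarksOnes m ms b
  ∈-markings⁻ b b∈ = Product.map₁ (∈-boolWords⁻ N b) (∈-filter⁻ (λ b → trues b ≟ m) b∈)
  forth : ∀ {w} → w ∈ interleavings (m ∷ ms) →
          split w ∈ cartesianProduct markings (interleavings ms) × uncurry merge (split w) ≡ w
  forth {w} w∈ with ∈-interleavings⁻ (m ∷ ms) w w∈
  ... | interleaving@(_ , letters , _) with split-interleaving m ms w interleaving
  ... | marks , interleaving′ =
    ∈-cartesianProduct⁺ (∈-markings⁺ _ marks) (∈-interleavings⁺ ms _ interleaving′) ,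
    merge-split w (letters-positive letters)
  back : ∀ {p} → p ∈ cartesianProduct markings (interleavings ms) →
         uncurry merge p ∈ interleavings (m ∷ ms) × split (uncurry merge p) ≡ p
  back {b , v} p∈ with ∈-cartesianProduct⁻ markings (interleavings ms) p∈
  ... | b∈ , v∈ with merge-interleaving m ms b v (∈-markings⁻ b b∈) (∈-interleavings⁻ ms v v∈)
  ...   | interleaving , split∘merge = ∈-interleavings⁺ (m ∷ ms) _ interleaving , split∘merge

length-recordedBy : ∀ μ λ′ T → All (0 <_) λ′ → shape T ≡ λ′ → IsStandard (sum μ) T →
                    length (filter (λ w → tableau? (recordingTableau (deck μ w)) T) (interleavings μ))
                    ≡ kostka λ′ μ
length-recordedBy μ λ′ T λ′-positive shapeT standardT =
  length-bijection (proj₁ ∘ rsk) (λ S → unRSK N S T)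
    (Unique.filter⁺ _ (Unique.filter⁺ _ (Unique-words N k))) (Unique.filter⁺ _ (Unique-fillings λ′ k))
    forth back
  where
  N = sum μ
  k = length μ
  recordedBy? = λ w → tableau? (recordingTableau (deck μ w)) T
  kostka? = λ S → isSSYT? S ×-dec ≡-dec _≟_ (content k (concat S)) μ
  open Deck μ using (recordingTableau-deck)
  forth : ∀ {w} → w ∈ filter recordedBy? (interleavings μ) →
          proj₁ (rsk w) ∈ filter kostka? (fillings λ′ k) × unRSK N (proj₁ (rsk w)) T ≡ w
  forth {w} w∈ with ∈-filter⁻ recordedBy? w∈
  ... | w∈interleavings , recorded with ∈-interleavings⁻ μ w w∈interleavings
  ... | len , letters , content≡ =
    ∈-filter⁺ kostka?
      (∈-fillings⁺ λ′ k P (trans (sameShape I) (trans (cong shape Q≡T) shapeT))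
                   (concat⁻ (All-resp-↭ (↭-sym (↭-word I)) letters)))
      (ssyt I , trans (content-↭ k (↭-word I)) content≡) ,
    subst (λ n → unRSK n P T ≡ w) len (subst (λ Q → unRSK (length w) P Q ≡ w) Q≡T (unRSK-rsk w))
    where
    open RSKPair
    I = rsk-pair w
    P = proj₁ (rsk w)
    Q≡T : proj₂ (rsk w) ≡ T
    Q≡T = trans (sym (recordingTableau-deck w letters content≡)) recorded
  back : ∀ {S} → S ∈ filter kostka? (fillings λ′ k) →
         unRSK N S T ∈ filter recordedBy? (interleavings μ) × proj₁ (rsk (unRSK N S T)) ≡ S
  back {S} S∈ with ∈-filter⁻ kostka? S∈
  ... | S∈fillings , ssytS , contentS with ∈-fillings⁻ λ′ k S S∈fillings
  ... | shapeS , lettersS =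
    ∈-filter⁺ recordedBy? (∈-interleavings⁺ μ w (proj₂ R , letters , content≡))
      (trans (recordingTableau-deck w letters content≡) (cong proj₂ (proj₁ R))) ,
    cong proj₁ (proj₁ R)
    where
    R = rsk-unRSK N T S standardT ssytS (subst (All (0 <_)) (sym shapeS) λ′-positive)
                  (trans shapeS (sym shapeT))
    w = unRSK N S T
    S↭w : concat S ↭ w
    S↭w = subst (λ p → concat (proj₁ p) ↭ w) (proj₁ R) (RSKPair.↭-word (rsk-pair w))
    letters : All (_∈ oneTo k) w
    letters = All-resp-↭ S↭w (concat⁺ lettersS)
    content≡ : content k w ≡ μ
    content≡ = trans (sym (content-↭ k S↭w)) contentS

lemma7p4 : (n : ℕ) (μ : List ℕ) → IsComposition n μ →
           (λ' : List ℕ) → IsPartition n λ' →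
           (T : Tableau) → IsSYT n λ' T →
           shuffleProb μ T ≡ (kostka λ' μ ÷ℕ multinomial μ)
lemma7p4 n μ (_ , refl) λ' (_ , λ'-positive , _) T (shapeT , T↭ , rows , columns) =
  cong₂ _÷ℕ_ (length-recordedBy μ λ' T λ'-positive shapeT
                (T↭ , rows , columns , subst (All (0 <_)) (sym shapeT) λ'-positive))
             (length-interleavings μ)
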